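{- For the $4$-dimensional hypercube graph $Q_4$, $\mathrm{sn}(Q_4)=\mathrm{gon}(Q_4)=8$.
   Context: $Q_n$ has vertex set $\{0,1\}^n$, two vertices adjacent iff they differ in exactly one coordinate. A scramble on $G$ is a collection $\mathcal{S}$ of nonempty vertex sets each inducing a connected subgraph (eggs); $h(\mathcal{S})$ is the minimum size of a set meeting every egg; an egg-cut is $A\subseteq V(G)$ with both $A$ and $A^C$ containing an egg, of size $|E(A,A^C)|$; $e(\mathcal{S})$ is the minimum size of an egg-cut ($\infty$ if none); the order is $\min(h(\mathcal{S}),e(\mathcal{S}))$; $\mathrm{sn}(G)$ is the maximum order of a scramble. A divisor is $D:V(G)\to\mathbb{Z}$, of degree $\sum_vD(v)$, effective if nonnegative; firing $v$ subtracts $\mathrm{val}(v)$ from $D(v)$ and adds the number of edges $vw$ to each $D(w)$, $w\ne v$; equivalence is via finite sequences of firings. $\mathrm{gon}(G)$ is the minimum degree of a divisor $D$ such that for every vertex $q$, $D$ minus one chip at $q$ is equivalent to an effective divisor. -}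

module Defs where

open import Data.Nat using (ℕ; zero; suc; _≤_; _≡ᵇ_)
open import Data.Bool using (Bool; true; false; if_then_else_)
open import Data.Vec using (Vec; []; _∷_)
open import Data.List using (List; []; _∷_; _++_; map; filterᵇ; length; foldr)
open import Data.List.Membership.Propositional using (_∈_)
open import Data.Integer as ℤ using (ℤ; +_)
open import Data.Product using (Σ; ∃; _×_; _,_)
open import Data.Empty using (⊥)
open import Relation.Binary.PropositionalEquality using (_≡_)
open import Relation.Binary.Construct.Closure.ReflexiveTransitive using (Star)

V : ℕ → Set
V n = Vec Bool n

allV : (n : ℕ) → List (V n)
allV zero = [] ∷ []
allV (suc n) = map (true ∷_) (allV n) ++ map (false ∷_) (allV n)

hamming : ∀ {n} → V n → V n → ℕ
hamming [] [] = 0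
hamming (true ∷ u) (true ∷ v) = hamming u v
hamming (false ∷ u) (false ∷ v) = hamming u v
hamming (true ∷ u) (false ∷ v) = suc (hamming u v)
hamming (false ∷ u) (true ∷ v) = suc (hamming u v)

adjᵇ : ∀ {n} → V n → V n → Bool
adjᵇ u v = hamming u v ≡ᵇ 1

Adj : ∀ {n} → V n → V n → Set
Adj u v = adjᵇ u v ≡ true

eqᵇ : ∀ {n} → V n → V n → Bool
eqᵇ u v = hamming u v ≡ᵇ 0

VSet : ℕ → Set
VSet n = V n → Bool

size : ∀ {n} → VSet n → ℕ
size {n} A = length (filterᵇ A (allV n))

complement : ∀ {n} → VSet n → VSet n
complement A v = Data.Bool.not (A v)

-- |E(A, A^C)| : number of pairs (u , w) with u ∈ A, w ∉ A, u adjacent to w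
-- (each edge of the simple graph Q n across the cut is counted exactly once)
cutSize : ∀ {n} → VSet n → ℕ
cutSize {n} A =
  foldr Data.Nat._+_ 0
    (map (λ u → length (filterᵇ (λ w → A u Data.Bool.∧ Data.Bool.not (A w) Data.Bool.∧ adjᵇ u w) (allV n)))
         (allV n))

data WalkIn {n} (E : VSet n) : V n → V n → Set where
  here : ∀ {u} → E u ≡ true → WalkIn E u u
  step : ∀ {u w v} → E u ≡ true → Adj u w → WalkIn E w v → WalkIn E u v

InducesConnected : ∀ {n} → VSet n → Set
InducesConnected {n} E = (u v : V n) → E u ≡ true → E v ≡ true → WalkIn E u v

Nonempty : ∀ {n} → VSet n → Set
Nonempty E = ∃ λ v → E v ≡ true

IsEgg : ∀ {n} → VSet n → Set
IsEgg E = Nonempty E × InducesConnected E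

record Scramble (n : ℕ) : Set where
  field
    eggs : List (VSet n)
    eggsAreEggs : ∀ {E} → E ∈ eggs → IsEgg E
open Scramble public

Meets : ∀ {n} → VSet n → VSet n → Set
Meets T E = ∃ λ v → (E v ≡ true) × (T v ≡ true)

HittingSet : ∀ {n} → Scramble n → VSet n → Set
HittingSet S T = ∀ {E} → E ∈ eggs S → Meets T E

SubsetOf : ∀ {n} → VSet n → VSet n → Set
SubsetOf E A = ∀ v → E v ≡ true → A v ≡ true

ContainsEgg : ∀ {n} → Scramble n → VSet n → Set
ContainsEgg S A = ∃ λ E → (E ∈ eggs S) × SubsetOf E A

EggCut : ∀ {n} → Scramble n → VSet n → Set
EggCut S A = ContainsEgg S A × ContainsEgg S (complement A)

-- order(S) = min(h(S), e(S)) ≥ k, i.e. h(S) ≥ k and e(S) ≥ k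
-- (e(S) = ∞ when there is no egg-cut, which satisfies e(S) ≥ k vacuously)
OrderAtLeast : ∀ {n} → Scramble n → ℕ → Set
OrderAtLeast S k =
  (∀ T → HittingSet S T → k ≤ size T) × (∀ A → EggCut S A → k ≤ cutSize A)

ScrambleNumberIs : ℕ → ℕ → Set
ScrambleNumberIs n k =
  (Σ (Scramble n) λ S → OrderAtLeast S k) ×
  (∀ (S : Scramble n) → OrderAtLeast S (suc k) → ⊥)

Divisor : ℕ → Set
Divisor n = V n → ℤ

degree : ∀ {n} → Divisor n → ℤ
degree {n} D = foldr ℤ._+_ (+ 0) (map D (allV n))

Effective : ∀ {n} → Divisor n → Set
Effective {n} D = ∀ (v : V n) → + 0 ℤ.≤ D v

valence : ∀ {n} → V n → ℕ
valence {n} v = length (filterᵇ (adjᵇ v) (allV n))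

edges : ∀ {n} → V n → V n → ℕ
edges v w = if adjᵇ v w then 1 else 0

fire : ∀ {n} → Divisor n → V n → Divisor n
fire D v w = if eqᵇ v w then D w ℤ.- + valence v else D w ℤ.+ + edges v w

Fires : ∀ {n} → Divisor n → Divisor n → Set
Fires {n} D D' = ∃ λ (v : V n) → ∀ w → D' w ≡ fire D v w

Equiv : ∀ {n} → Divisor n → Divisor n → Set
Equiv = Star Fires

minusChip : ∀ {n} → Divisor n → V n → Divisor n
minusChip D q w = if eqᵇ q w then D w ℤ.- + 1 else D w

PositiveRank : ∀ {n} → Divisor n → Set
PositiveRank {n} D = ∀ (q : V n) → ∃ λ D' → Equiv (minusChip D q) D' × Effective D'

GonalityIs : ℕ → ℕ → Set
GonalityIs n k =
  (Σ (Divisor n) λ D → PositiveRank D × degree D ≡ + k) ×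
  (∀ (D : Divisor n) → PositiveRank D → + k ℤ.≤ degree D)

-- Q₄ is C₄ □ C₄, and the eggs of the scramble are the sixteen 3-vertex paths inside the four
-- faces {x} × C₄.  A hitting set needs two vertices in every face, and an egg-cut separates
-- two sets of between 3 and 13 vertices, whose cut is at least 8 by the halving bound on the
-- edge-isoperimetric profile of Qₙ.  A facet (first coordinate fixed) has 8 vertices, 8
-- complementary vertices and 8 cut edges, so no scramble has order 9.  One chip on each facet
-- vertex has positive rank (firing the facet moves every chip across its matching edge).
-- Conversely, an effective divisor of degree ≤ 7 and positive rank can be stabilised by firing
-- single vertices with ≥ 4 chips and edges with ≥ 3 chips at both ends (Σ D(v)² decreases).
-- Some egg is then chip-free; removing a chip from it, the vertices of maximal value of a
-- firing script that restores effectivity form a legal firing set avoiding that egg.  Its cut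
-- is at most 7, so it has at most two vertices, which stability rules out.

module Submission where

open import Defs
open import Algebra.Bundles using (CommutativeSemigroup)
open import Algebra.Structures using (IsCommutativeMonoid)
import Algebra.Properties.CommutativeSemigroup as CommutativeSemigroupProperties
open import Data.Bool as Bool using (Bool; true; false; not; _∧_; _∨_; if_then_else_)
import Data.Bool.Properties as Boolₚ
open import Data.Bool.ListAction using (all)
open import Data.Empty using (⊥; ⊥-elim)
open import Data.Integer as ℤ using (ℤ; +_; _⊖_)
import Data.Integer.Properties as ℤₚ
open import Data.Integer.Tactic.RingSolver using (solve-∀)
open import Data.List using (List; []; _∷_; _++_; map; foldr; length; filterᵇ; upTo)
open import Data.List.Extrema ℤₚ.≤-totalOrder using (argmax; f[xs]≤f[argmax])
open import Data.List.Membership.Propositional using (_∈_; find; lose)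
open import Data.List.Membership.Propositional.Properties using (∈-map⁺; ∈-map⁻; ∈-++⁺ˡ; ∈-++⁺ʳ; ∈-upTo⁺)
open import Data.List.Relation.Unary.All as All using (All; all?)
open import Data.List.Relation.Unary.All.Properties using (¬All⇒Any¬)
open import Data.List.Relation.Unary.Any as Any using (here; there)
open import Data.Nat as ℕ using (ℕ; zero; suc; _+_; _*_; _∸_; _⊓_; ∣_-_∣; _≤_; _<_; z≤n; s≤s)
open import Data.Nat.Induction using (<-wellFounded)
import Data.Nat.Properties as ℕₚ
open import Data.Nat.Tactic.RingSolver using () renaming (solve-∀ to solve-∀ℕ)
open import Data.Product using (∃; ∃₂; _×_; _,_)
open import Data.Sum using (_⊎_; inj₁; inj₂; [_,_]′)
open import Data.Vec using (Vec; []; _∷_)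
open import Function using (_∘_)
open import Function.Bundles using (Equivalence)
open import Induction.WellFounded using (Acc; acc)
open import Relation.Binary.Construct.Closure.ReflexiveTransitive using (ε; _◅_)
open import Relation.Binary.PropositionalEquality
open import Relation.Nullary using (¬_)
open import Relation.Nullary.Decidable using (Dec; yes; no; map′; toWitness; _→-dec_; _×-dec_; _⊎-dec_)

module Sums {A : Set} {_∙_ : A → A → A} {ε : A}
            (isCM : IsCommutativeMonoid _≡_ _∙_ ε) where

  open IsCommutativeMonoid isCM using (assoc; identityˡ; identityʳ; isCommutativeSemigroup)

  commutativeSemigroup : CommutativeSemigroup _ _
  commutativeSemigroup = record { isCommutativeSemigroup = isCommutativeSemigroup }

  open CommutativeSemigroupProperties commutativeSemigroup using (interchange)

  ∑ : {X : Set} → (X → A) → List X → A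
  ∑ f xs = foldr _∙_ ε (map f xs)

  private variable X Y : Set

  ∑-cong : ∀ {f g : X → A} xs → (∀ x → f x ≡ g x) → ∑ f xs ≡ ∑ g xs
  ∑-cong []       f≗g = refl
  ∑-cong (x ∷ xs) f≗g = cong₂ _∙_ (f≗g x) (∑-cong xs f≗g)

  ∑-ε : ∀ (xs : List X) → ∑ (λ _ → ε) xs ≡ ε
  ∑-ε []       = refl
  ∑-ε (x ∷ xs) = trans (identityˡ _) (∑-ε xs)

  ∑-∙ : ∀ (f g : X → A) xs → ∑ (λ x → f x ∙ g x) xs ≡ ∑ f xs ∙ ∑ g xs
  ∑-∙ f g []       = sym (identityˡ ε)
  ∑-∙ f g (x ∷ xs) = trans (cong ((f x ∙ g x) ∙_) (∑-∙ f g xs))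
                           (interchange (f x) (g x) _ _)

  ∑-++ : ∀ (f : X → A) xs ys → ∑ f (xs ++ ys) ≡ ∑ f xs ∙ ∑ f ys
  ∑-++ f []       ys = sym (identityˡ _)
  ∑-++ f (x ∷ xs) ys = trans (cong (f x ∙_) (∑-++ f xs ys)) (sym (assoc _ _ _))

  ∑-map : ∀ (f : Y → A) (g : X → Y) xs → ∑ f (map g xs) ≡ ∑ (f ∘ g) xs
  ∑-map f g []       = refl
  ∑-map f g (x ∷ xs) = cong (f (g x) ∙_) (∑-map f g xs)

  ∑-comm : ∀ (f : X → Y → A) xs ys →
           ∑ (λ x → ∑ (f x) ys) xs ≡ ∑ (λ y → ∑ (λ x → f x y) xs) ys
  ∑-comm f []       ys = sym (∑-ε ys)
  ∑-comm f (x ∷ xs) ys = trans (cong (∑ (f x) ys ∙_) (∑-comm f xs ys))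
                               (sym (∑-∙ (f x) _ ys))

  ∑-allV-suc : ∀ {n} (f : V (suc n) → A) →
               ∑ f (allV (suc n)) ≡ ∑ (f ∘ (true ∷_)) (allV n) ∙ ∑ (f ∘ (false ∷_)) (allV n)
  ∑-allV-suc {n} f = trans (∑-++ f (map (true ∷_) (allV n)) _)
                           (cong₂ _∙_ (∑-map f _ (allV n)) (∑-map f _ (allV n)))

  ∑-eqᵇ : ∀ {n} (u : V n) (f : V n → A) →
          ∑ (λ w → if eqᵇ u w then f w else ε) (allV n) ≡ f u
  ∑-eqᵇ [] f = identityʳ (f [])
  ∑-eqᵇ {suc n} (true ∷ u) f = begin
    ∑ (λ w → if eqᵇ (true ∷ u) w then f w else ε) (allV (suc n))
      ≡⟨ ∑-allV-suc {n} (λ w → if eqᵇ (true ∷ u) w then f w else ε) ⟩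
    ∑ (λ w → if eqᵇ u w then f (true ∷ w) else ε) (allV n) ∙ ∑ (λ _ → ε) (allV n)
      ≡⟨ cong₂ _∙_ (∑-eqᵇ u (f ∘ (true ∷_))) (∑-ε (allV n)) ⟩
    f (true ∷ u) ∙ ε  ≡⟨ identityʳ _ ⟩
    f (true ∷ u)      ∎
    where open ≡-Reasoning
  ∑-eqᵇ {suc n} (false ∷ u) f = begin
    ∑ (λ w → if eqᵇ (false ∷ u) w then f w else ε) (allV (suc n))
      ≡⟨ ∑-allV-suc {n} (λ w → if eqᵇ (false ∷ u) w then f w else ε) ⟩
    ∑ (λ _ → ε) (allV n) ∙ ∑ (λ w → if eqᵇ u w then f (false ∷ w) else ε) (allV n)
      ≡⟨ cong₂ _∙_ (∑-ε (allV n)) (∑-eqᵇ u (f ∘ (false ∷_))) ⟩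
    ε ∙ f (false ∷ u)  ≡⟨ identityˡ _ ⟩
    f (false ∷ u)      ∎
    where open ≡-Reasoning

module ℕΣ = Sums ℕₚ.+-0-isCommutativeMonoid
module ℤΣ = Sums ℤₚ.+-0-isCommutativeMonoid
open ℕΣ using () renaming (∑ to ∑ℕ)
open ℤΣ using () renaming (∑ to ∑ℤ)

private variable
  X : Set
  n : ℕ

∑ℕ-mono : ∀ {f g : X → ℕ} xs → (∀ x → f x ≤ g x) → ∑ℕ f xs ≤ ∑ℕ g xs
∑ℕ-mono []       f≤g = z≤n
∑ℕ-mono (x ∷ xs) f≤g = ℕₚ.+-mono-≤ (f≤g x) (∑ℕ-mono xs f≤g)

∑ℤ-mono : ∀ {f g : X → ℤ} xs → (∀ x → f x ℤ.≤ g x) → ∑ℤ f xs ℤ.≤ ∑ℤ g xs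
∑ℤ-mono []       f≤g = ℤₚ.≤-refl
∑ℤ-mono (x ∷ xs) f≤g = ℤₚ.+-mono-≤ (f≤g x) (∑ℤ-mono xs f≤g)

∑ℤ-+ : ∀ (f : X → ℕ) xs → ∑ℤ (λ x → + f x) xs ≡ + ∑ℕ f xs
∑ℤ-+ f []       = refl
∑ℤ-+ f (x ∷ xs) = cong (ℤ._+_ (+ f x)) (∑ℤ-+ f xs)

∑ℤ-neg : ∀ (f : X → ℤ) xs → ∑ℤ (λ x → ℤ.- f x) xs ≡ ℤ.- ∑ℤ f xs
∑ℤ-neg f []       = refl
∑ℤ-neg f (x ∷ xs) = trans (cong (ℤ._+_ (ℤ.- f x)) (∑ℤ-neg f xs)) (sym (ℤₚ.neg-distrib-+ (f x) _))

⟦_⟧ : Bool → ℕ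
⟦ b ⟧ = if b then 1 else 0

count : (X → Bool) → List X → ℕ
count p = ∑ℕ (λ x → ⟦ p x ⟧)

length-filterᵇ : ∀ (p : X → Bool) xs → length (filterᵇ p xs) ≡ count p xs
length-filterᵇ p []       = refl
length-filterᵇ p (x ∷ xs) with p x
... | true  = cong suc (length-filterᵇ p xs)
... | false = length-filterᵇ p xs

count-complement : ∀ (p : X → Bool) xs → count p xs + count (not ∘ p) xs ≡ length xs
count-complement p []       = refl
count-complement p (x ∷ xs) with p x
... | true  = cong suc (count-complement p xs)
... | false = trans (ℕₚ.+-suc _ _) (cong suc (count-complement p xs))

count≤count+count∖ : ∀ (p q : X → Bool) xs → count p xs ≤ count q xs + count (λ x → p x ∧ not (q x)) xs
count≤count+count∖ p q xs = ℕₚ.≤-trans (∑ℕ-mono xs pointwise) (ℕₚ.≤-reflexive (ℕΣ.∑-∙ _ _ xs))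
  where
  pointwise : ∀ x → ⟦ p x ⟧ ≤ ⟦ q x ⟧ + ⟦ p x ∧ not (q x) ⟧
  pointwise x with p x | q x
  ... | true  | true  = s≤s z≤n
  ... | true  | false = s≤s z≤n
  ... | false | _     = z≤n

count-pos : ∀ (p : X → Bool) xs → 1 ≤ count p xs → ∃ λ x → p x ≡ true
count-pos p (x ∷ xs) pos with p x in px
... | true  = x , px
... | false = count-pos p xs pos

count≡0⇒false : ∀ (p : X → Bool) xs → count p xs ≡ 0 → ∀ {x} → x ∈ xs → p x ≡ false
count≡0⇒false p (y ∷ xs) none x∈ with p y in py
count≡0⇒false p (y ∷ xs) none (here refl) | false = py
count≡0⇒false p (y ∷ xs) none (there x∈)  | false = count≡0⇒false p xs none x∈

eqᵇ-refl : ∀ (u : V n) → eqᵇ u u ≡ true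
eqᵇ-refl []          = refl
eqᵇ-refl (true ∷ u)  = eqᵇ-refl u
eqᵇ-refl (false ∷ u) = eqᵇ-refl u

eqᵇ⇒≡ : ∀ (u v : V n) → eqᵇ u v ≡ true → u ≡ v
eqᵇ⇒≡ []          []          _ = refl
eqᵇ⇒≡ (true ∷ u)  (true ∷ v)  p = cong (true ∷_) (eqᵇ⇒≡ u v p)
eqᵇ⇒≡ (false ∷ u) (false ∷ v) p = cong (false ∷_) (eqᵇ⇒≡ u v p)

hamming-sym : ∀ (u v : V n) → hamming u v ≡ hamming v u
hamming-sym []          []          = refl
hamming-sym (true ∷ u)  (true ∷ v)  = hamming-sym u v
hamming-sym (true ∷ u)  (false ∷ v) = cong suc (hamming-sym u v)
hamming-sym (false ∷ u) (true ∷ v)  = cong suc (hamming-sym u v)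
hamming-sym (false ∷ u) (false ∷ v) = hamming-sym u v

adjᵇ-sym : ∀ (u v : V n) → adjᵇ u v ≡ adjᵇ v u
adjᵇ-sym u v = cong (ℕ._≡ᵇ 1) (hamming-sym u v)

adjᵇ⇒¬eqᵇ : ∀ (u v : V n) → adjᵇ u v ≡ true → eqᵇ u v ≡ false
adjᵇ⇒¬eqᵇ u v adj with hamming u v
... | suc _ = refl

allV-complete : ∀ (v : V n) → v ∈ allV n
allV-complete []                = here refl
allV-complete {suc n} (true ∷ v)  = ∈-++⁺ˡ (∈-map⁺ (true ∷_) (allV-complete v))
allV-complete {suc n} (false ∷ v) = ∈-++⁺ʳ (map (true ∷_) (allV n)) (∈-map⁺ (false ∷_) (allV-complete v))

Adj-sym : ∀ {u v : V n} → Adj u v → Adj v u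
Adj-sym {u = u} {v} uv = trans (adjᵇ-sym v u) uv

∷-Adj : ∀ x {u v : V n} → Adj u v → Adj (x ∷ u) (x ∷ v)
∷-Adj true  uv = uv
∷-Adj false uv = uv

-- Splitting allV (suc n) at the first coordinate, adjᵇ (b ∷ u) (b ∷ w) reduces to adjᵇ u w
-- and adjᵇ (b ∷ u) (not b ∷ w) to eqᵇ u w; this drives every induction on n below.
valence≡n : ∀ (v : V n) → valence v ≡ n
valence≡n {n} v = trans (length-filterᵇ (adjᵇ v) (allV n)) (count-adjᵇ v)
  where
  count-eqᵇ : ∀ {n} (u : V n) → count (eqᵇ u) (allV n) ≡ 1
  count-eqᵇ u = ℕΣ.∑-eqᵇ u (λ _ → 1)
  count-adjᵇ : ∀ {n} (u : V n) → count (adjᵇ u) (allV n) ≡ n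
  count-adjᵇ []          = refl
  count-adjᵇ {suc n} (true ∷ u) = begin
    count (adjᵇ (true ∷ u)) (allV (suc n))
      ≡⟨ ℕΣ.∑-allV-suc (λ w → ⟦ adjᵇ (true ∷ u) w ⟧) ⟩
    count (adjᵇ u) (allV n) + count (eqᵇ u) (allV n)
      ≡⟨ cong₂ _+_ (count-adjᵇ u) (count-eqᵇ u) ⟩
    n + 1  ≡⟨ ℕₚ.+-comm n 1 ⟩
    suc n  ∎
    where open ≡-Reasoning
  count-adjᵇ {suc n} (false ∷ u) = begin
    count (adjᵇ (false ∷ u)) (allV (suc n))
      ≡⟨ ℕΣ.∑-allV-suc (λ w → ⟦ adjᵇ (false ∷ u) w ⟧) ⟩
    count (eqᵇ u) (allV n) + count (adjᵇ u) (allV n)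
      ≡⟨ cong₂ _+_ (count-eqᵇ u) (count-adjᵇ u) ⟩
    suc n  ∎
    where open ≡-Reasoning

all-V? : ∀ {P : V n → Set} → (∀ v → Dec (P v)) → Dec (∀ v → P v)
all-V? {n} P? = map′ (λ ps v → All.lookup ps (allV-complete v)) (λ f → All.tabulate (λ {v} _ → f v))
                     (all? P? (allV n))

¬∀⇒∃¬ : ∀ {P : V n → Set} → (∀ v → Dec (P v)) → ¬ (∀ v → P v) → ∃ λ v → ¬ P v
¬∀⇒∃¬ {n} P? ¬∀ with all? P? (allV n)
... | yes ps = ⊥-elim (¬∀ (λ v → All.lookup ps (allV-complete v)))
... | no ¬all = Any.satisfied (¬All⇒Any¬ P? (allV n) ¬all)

_++ʷ_ : ∀ {E : VSet n} {u v w} → WalkIn E u v → WalkIn E v w → WalkIn E u w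
here _         ++ʷ q = q
step Eu uw p   ++ʷ q = step Eu uw (p ++ʷ q)

walk-closed : ∀ {E A : VSet n} → (∀ u w → E u ≡ true → A u ≡ true → Adj u w → A w ≡ true) →
  ∀ {u v} → WalkIn E u v → A u ≡ true → A v ≡ true
walk-closed closed (here _)       Au = Au
walk-closed closed (step Eu uw p) Au = walk-closed closed p (closed _ _ Eu Au uw)

size≡count : ∀ (A : VSet n) → size A ≡ count A (allV n)
size≡count {n} A = length-filterᵇ A (allV n)

size-cong : ∀ {A B : VSet n} → (∀ v → A v ≡ B v) → size A ≡ size B
size-cong {n} {A} {B} A≗B = begin
  size A            ≡⟨ size≡count A ⟩
  count A (allV n)  ≡⟨ ℕΣ.∑-cong (allV n) (λ v → cong ⟦_⟧ (A≗B v)) ⟩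
  count B (allV n)  ≡⟨ size≡count B ⟨
  size B            ∎
  where open ≡-Reasoning

size-mono : ∀ {E A : VSet n} → SubsetOf E A → size E ≤ size A
size-mono {n} {E} {A} E⊆A = subst₂ _≤_ (sym (size≡count E)) (sym (size≡count A)) (∑ℕ-mono (allV n) pointwise)
  where
  pointwise : ∀ v → ⟦ E v ⟧ ≤ ⟦ A v ⟧
  pointwise v with E v in Ev
  ... | false = z≤n
  ... | true rewrite E⊆A v Ev = ℕₚ.≤-refl

size+size-complement : ∀ (A : VSet n) → size A + size (complement A) ≡ length (allV n)
size+size-complement {n} A =
  trans (cong₂ _+_ (size≡count A) (size≡count (complement A))) (count-complement A (allV n))

size-suc : ∀ (A : VSet (suc n)) → size A ≡ size (A ∘ (true ∷_)) + size (A ∘ (false ∷_))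
size-suc {n} A = begin
  size A                                                  ≡⟨ size≡count A ⟩
  count A (allV (suc n))                                  ≡⟨ ℕΣ.∑-allV-suc (λ v → ⟦ A v ⟧) ⟩
  count (A ∘ (true ∷_)) (allV n) + count (A ∘ (false ∷_)) (allV n)
    ≡⟨ cong₂ _+_ (size≡count (A ∘ (true ∷_))) (size≡count (A ∘ (false ∷_))) ⟨
  size (A ∘ (true ∷_)) + size (A ∘ (false ∷_))            ∎
  where open ≡-Reasoning

outDegree : VSet n → V n → ℕ
outDegree {n} A u = count (λ w → not (A w) ∧ adjᵇ u w) (allV n)

inDegree : VSet n → V n → ℕ
inDegree {n} A u = count (λ w → A w ∧ adjᵇ u w) (allV n)

count-∧eqᵇ : ∀ (p : V n → Bool) u → count (λ w → p w ∧ eqᵇ u w) (allV n) ≡ ⟦ p u ⟧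
count-∧eqᵇ {n} p u = trans (ℕΣ.∑-cong (allV n) guard) (ℕΣ.∑-eqᵇ u (λ w → ⟦ p w ⟧))
  where
  guard : ∀ w → ⟦ p w ∧ eqᵇ u w ⟧ ≡ (if eqᵇ u w then ⟦ p w ⟧ else 0)
  guard w with p w | eqᵇ u w
  ... | true  | b     = refl
  ... | false | true  = refl
  ... | false | false = refl

outDegree+inDegree : ∀ (A : VSet n) u → outDegree A u + inDegree A u ≡ valence u
outDegree+inDegree {n} A u = begin
  outDegree A u + inDegree A u
    ≡⟨ ℕΣ.∑-∙ (λ w → ⟦ not (A w) ∧ adjᵇ u w ⟧) (λ w → ⟦ A w ∧ adjᵇ u w ⟧) (allV n) ⟨
  ∑ℕ (λ w → ⟦ not (A w) ∧ adjᵇ u w ⟧ + ⟦ A w ∧ adjᵇ u w ⟧) (allV n)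
    ≡⟨ ℕΣ.∑-cong (allV n) split ⟩
  count (adjᵇ u) (allV n)
    ≡⟨ length-filterᵇ (adjᵇ u) (allV n) ⟨
  valence u  ∎
  where
  open ≡-Reasoning
  split : ∀ w → ⟦ not (A w) ∧ adjᵇ u w ⟧ + ⟦ A w ∧ adjᵇ u w ⟧ ≡ ⟦ adjᵇ u w ⟧
  split w with A w | adjᵇ u w
  ... | true  | b     = refl
  ... | false | true  = refl
  ... | false | false = refl

suc-inDegree≤size : ∀ (A : VSet n) u → A u ≡ true → suc (inDegree A u) ≤ size A
suc-inDegree≤size {n} A u Au = begin
  suc (inDegree A u)
    ≤⟨ s≤s (∑ℕ-mono (allV n) adj⇒≢) ⟩
  1 + count (λ w → A w ∧ not (eqᵇ u w)) (allV n)
    ≡⟨ cong₂ _+_ (trans (cong ⟦_⟧ (sym Au)) (sym (count-∧eqᵇ A u))) refl ⟩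
  count (λ w → A w ∧ eqᵇ u w) (allV n) + count (λ w → A w ∧ not (eqᵇ u w)) (allV n)
    ≡⟨ ℕΣ.∑-∙ (λ w → ⟦ A w ∧ eqᵇ u w ⟧) (λ w → ⟦ A w ∧ not (eqᵇ u w) ⟧) (allV n) ⟨
  ∑ℕ (λ w → ⟦ A w ∧ eqᵇ u w ⟧ + ⟦ A w ∧ not (eqᵇ u w) ⟧) (allV n)
    ≡⟨ ℕΣ.∑-cong (allV n) split ⟩
  count A (allV n)
    ≡⟨ size≡count A ⟨
  size A  ∎
  where
  open ℕₚ.≤-Reasoning
  adj⇒≢ : ∀ w → ⟦ A w ∧ adjᵇ u w ⟧ ≤ ⟦ A w ∧ not (eqᵇ u w) ⟧
  adj⇒≢ w with A w | adjᵇ u w in adj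
  ... | false | _     = z≤n
  ... | true  | false = z≤n
  ... | true  | true  rewrite adjᵇ⇒¬eqᵇ u w adj = ℕₚ.≤-refl
  split : ∀ w → ⟦ A w ∧ eqᵇ u w ⟧ + ⟦ A w ∧ not (eqᵇ u w) ⟧ ≡ ⟦ A w ⟧
  split w with A w | eqᵇ u w
  ... | false | _     = refl
  ... | true  | true  = refl
  ... | true  | false = refl

outDegree≡0⇒Adj⇒∈ : ∀ (A : VSet n) u w → outDegree A u ≡ 0 → Adj u w → A w ≡ true
outDegree≡0⇒Adj⇒∈ {n} A u w none uw
  with count≡0⇒false (λ x → not (A x) ∧ adjᵇ u x) (allV n) none (allV-complete w)
... | leaves rewrite uw = trans (sym (Boolₚ.not-involutive (A w))) (cong not (trans (sym (Boolₚ.∧-identityʳ _)) leaves))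

cutSize≡∑∑ : ∀ (A : VSet n) →
  cutSize A ≡ ∑ℕ (λ u → count (λ w → A u ∧ not (A w) ∧ adjᵇ u w) (allV n)) (allV n)
cutSize≡∑∑ {n} A = ℕΣ.∑-cong (allV n) (λ u → length-filterᵇ _ (allV n))

cutSize≡∑outDegree : ∀ (A : VSet n) →
  cutSize A ≡ ∑ℕ (λ u → if A u then outDegree A u else 0) (allV n)
cutSize≡∑outDegree {n} A = trans (cutSize≡∑∑ A) (ℕΣ.∑-cong (allV n) pointwise)
  where
  pointwise : ∀ u → count (λ w → A u ∧ not (A w) ∧ adjᵇ u w) (allV n)
                  ≡ (if A u then outDegree A u else 0)
  pointwise u with A u
  ... | true  = refl
  ... | false = ℕΣ.∑-ε (allV n)

cutSize-complement : ∀ (A : VSet n) → cutSize (complement A) ≡ cutSize A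
cutSize-complement {n} A = begin
  cutSize (complement A)
    ≡⟨ cutSize≡∑∑ (complement A) ⟩
  ∑ℕ (λ u → ∑ℕ (λ w → ⟦ not (A u) ∧ not (not (A w)) ∧ adjᵇ u w ⟧) (allV n)) (allV n)
    ≡⟨ ℕΣ.∑-comm (λ u w → ⟦ not (A u) ∧ not (not (A w)) ∧ adjᵇ u w ⟧) (allV n) (allV n) ⟩
  ∑ℕ (λ w → ∑ℕ (λ u → ⟦ not (A u) ∧ not (not (A w)) ∧ adjᵇ u w ⟧) (allV n)) (allV n)
    ≡⟨ ℕΣ.∑-cong (allV n) (λ w → ℕΣ.∑-cong (allV n) (reverse w)) ⟩
  ∑ℕ (λ w → ∑ℕ (λ u → ⟦ A w ∧ not (A u) ∧ adjᵇ w u ⟧) (allV n)) (allV n)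
    ≡⟨ cutSize≡∑∑ A ⟨
  cutSize A  ∎
  where
  open ≡-Reasoning
  reverse : ∀ w u → ⟦ not (A u) ∧ not (not (A w)) ∧ adjᵇ u w ⟧ ≡ ⟦ A w ∧ not (A u) ∧ adjᵇ w u ⟧
  reverse w u rewrite adjᵇ-sym u w with A u | A w
  ... | true  | true  = refl
  ... | true  | false = refl
  ... | false | true  = refl
  ... | false | false = refl

count-∧∧eqᵇ : ∀ b (p : V n → Bool) u → count (λ w → b ∧ p w ∧ eqᵇ u w) (allV n) ≡ ⟦ b ∧ p u ⟧
count-∧∧eqᵇ {n} true  p u = count-∧eqᵇ p u
count-∧∧eqᵇ {n} false p u = ℕΣ.∑-ε (allV n)

cutSize-suc : ∀ (A : VSet (suc n)) → let A₁ = A ∘ (true ∷_); A₀ = A ∘ (false ∷_) in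
  cutSize A ≡ (cutSize A₁ + count (λ u → A₁ u ∧ not (A₀ u)) (allV n))
            + (count (λ u → A₀ u ∧ not (A₁ u)) (allV n) + cutSize A₀)
cutSize-suc {n} A = begin
  cutSize A
    ≡⟨ cutSize≡∑∑ A ⟩
  ∑ℕ (λ u → count (λ w → A u ∧ not (A w) ∧ adjᵇ u w) (allV (suc n))) (allV (suc n))
    ≡⟨ ℕΣ.∑-allV-suc (λ u → count (λ w → A u ∧ not (A w) ∧ adjᵇ u w) (allV (suc n))) ⟩
  ∑ℕ (λ u → count (λ w → A₁ u ∧ not (A w) ∧ adjᵇ (true ∷ u) w) (allV (suc n))) (allV n)
  + ∑ℕ (λ u → count (λ w → A₀ u ∧ not (A w) ∧ adjᵇ (false ∷ u) w) (allV (suc n))) (allV n)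
    ≡⟨ cong₂ _+_ true-half false-half ⟩
  (cutSize A₁ + count (λ u → A₁ u ∧ not (A₀ u)) (allV n))
  + (count (λ u → A₀ u ∧ not (A₁ u)) (allV n) + cutSize A₀)  ∎
  where
  open ≡-Reasoning
  A₁ A₀ : VSet n
  A₁ = A ∘ (true ∷_)
  A₀ = A ∘ (false ∷_)
  inner : ∀ (B : VSet n) b → ∑ℕ (λ u → count (λ w → B u ∧ not (A w) ∧ adjᵇ (b ∷ u) w) (allV (suc n))) (allV n)
        ≡ ∑ℕ (λ u → count (λ w → B u ∧ not (A₁ w) ∧ adjᵇ (b ∷ u) (true ∷ w)) (allV n)) (allV n)
        + ∑ℕ (λ u → count (λ w → B u ∧ not (A₀ w) ∧ adjᵇ (b ∷ u) (false ∷ w)) (allV n)) (allV n)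
  inner B b = trans (ℕΣ.∑-cong (allV n) (λ u → ℕΣ.∑-allV-suc (λ w → ⟦ B u ∧ not (A w) ∧ adjᵇ (b ∷ u) w ⟧)))
                    (ℕΣ.∑-∙ _ _ (allV n))
  true-half : ∑ℕ (λ u → count (λ w → A₁ u ∧ not (A w) ∧ adjᵇ (true ∷ u) w) (allV (suc n))) (allV n)
            ≡ cutSize A₁ + count (λ u → A₁ u ∧ not (A₀ u)) (allV n)
  true-half = trans (inner A₁ true)
    (cong₂ _+_ (sym (cutSize≡∑∑ A₁)) (ℕΣ.∑-cong (allV n) (λ u → count-∧∧eqᵇ (A₁ u) (not ∘ A₀) u)))
  false-half : ∑ℕ (λ u → count (λ w → A₀ u ∧ not (A w) ∧ adjᵇ (false ∷ u) w) (allV (suc n))) (allV n)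
             ≡ count (λ u → A₀ u ∧ not (A₁ u)) (allV n) + cutSize A₀
  false-half = trans (inner A₀ false)
    (cong₂ _+_ (ℕΣ.∑-cong (allV n) (λ u → count-∧∧eqᵇ (A₀ u) (not ∘ A₁) u)) (sym (cutSize≡∑∑ A₀)))

-- Edge-isoperimetry

minUpTo : (ℕ → ℕ) → ℕ → ℕ
minUpTo f zero    = f 0
minUpTo f (suc k) = f (suc k) ⊓ minUpTo f k

minUpTo-≤ : ∀ f {a k} → a ≤ k → minUpTo f k ≤ f a
minUpTo-≤ f {k = zero}  z≤n = ℕₚ.≤-refl
minUpTo-≤ f {k = suc k} a≤k with ℕₚ.m≤n⇒m<n∨m≡n a≤k
... | inj₁ a<k  = ℕₚ.≤-trans (ℕₚ.m⊓n≤n _ _) (minUpTo-≤ f (ℕₚ.≤-pred a<k))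
... | inj₂ refl = ℕₚ.m⊓n≤m _ _

-- Halving Qₙ₊₁ along the first coordinate, cut A = cut A₁ + cut A₀ + |A₁ ∖ A₀| + |A₀ ∖ A₁|
-- (cutSize-suc), and the last two terms are at least ∣ |A₁| - |A₀| ∣.  cutBound n k is the
-- resulting lower bound for k-element sets, minimised over all splits of k (splits that
-- cannot occur in Qₙ only weaken it).
cutBound : ℕ → ℕ → ℕ
cutBound zero    k = 0
cutBound (suc n) k = minUpTo (λ a → cutBound n a + cutBound n (k ∸ a) + ∣ a - (k ∸ a) ∣) k

cutBound≤cutSize : ∀ n (A : VSet n) → cutBound n (size A) ≤ cutSize A
cutBound≤cutSize zero    A = z≤n
cutBound≤cutSize (suc n) A = begin
  cutBound (suc n) (size A)
    ≡⟨ cong (cutBound (suc n)) (size-suc A) ⟩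
  cutBound (suc n) (a + b)
    ≤⟨ minUpTo-≤ _ (ℕₚ.m≤m+n a b) ⟩
  cutBound n a + cutBound n (a + b ∸ a) + ∣ a - (a + b ∸ a) ∣
    ≡⟨ cong (λ c → cutBound n a + cutBound n c + ∣ a - c ∣) (ℕₚ.m+n∸m≡n a b) ⟩
  cutBound n a + cutBound n b + ∣ a - b ∣
    ≤⟨ ℕₚ.+-mono-≤ (ℕₚ.+-mono-≤ (cutBound≤cutSize n A₁) (cutBound≤cutSize n A₀)) distance ⟩
  (cutSize A₁ + cutSize A₀) + (d₁₀ + d₀₁)
    ≡⟨ rearrange (cutSize A₁) (cutSize A₀) d₁₀ d₀₁ ⟩
  (cutSize A₁ + d₁₀) + (d₀₁ + cutSize A₀)
    ≡⟨ cutSize-suc A ⟨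
  cutSize A  ∎
  where
  open ℕₚ.≤-Reasoning
  A₁ A₀ : VSet n
  A₁ = A ∘ (true ∷_)
  A₀ = A ∘ (false ∷_)
  a b d₁₀ d₀₁ : ℕ
  a = size A₁
  b = size A₀
  d₁₀ = count (λ u → A₁ u ∧ not (A₀ u)) (allV n)
  d₀₁ = count (λ u → A₀ u ∧ not (A₁ u)) (allV n)
  rearrange : ∀ w x y z → (w + x) + (y + z) ≡ (w + y) + (z + x)
  rearrange = solve-∀ℕ
  monus≤ : ∀ (B C : VSet n) → size B ∸ size C ≤ count (λ u → B u ∧ not (C u)) (allV n)
  monus≤ B C = ℕₚ.m≤n+o⇒m∸n≤o (size B) (size C)
    (subst₂ (λ s t → s ≤ t + count (λ u → B u ∧ not (C u)) (allV n))
            (sym (size≡count B)) (sym (size≡count C)) (count≤count+count∖ B C (allV n)))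
  distance : ∣ a - b ∣ ≤ d₁₀ + d₀₁
  distance with ℕₚ.∣m-n∣≡[m∸n]∨[n∸m] a b
  ... | inj₁ eq = subst (_≤ d₁₀ + d₀₁) (sym eq) (ℕₚ.≤-trans (monus≤ A₁ A₀) (ℕₚ.m≤m+n d₁₀ d₀₁))
  ... | inj₂ eq = subst (_≤ d₁₀ + d₀₁) (sym eq) (ℕₚ.≤-trans (monus≤ A₀ A₁) (ℕₚ.m≤n+m d₀₁ d₁₀))

-- cutBound 4 k for k = 0, …, 16 is 0 4 6 8 8 10 10 10 8 10 10 10 8 8 6 4 0.
isoperimetric-Q₄ : ∀ (A : VSet 4) → 3 ≤ size A → size A ≤ 13 → 8 ≤ cutSize A
isoperimetric-Q₄ A 3≤|A| |A|≤13 =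
  ℕₚ.≤-trans (All.lookup table (∈-upTo⁺ (s≤s |A|≤13)) 3≤|A|) (cutBound≤cutSize 4 A)
  where
  table : All (λ k → 3 ≤ k → 8 ≤ cutBound 4 k) (upTo 14)
  table = toWitness {a? = all? (λ k → 3 ℕ.≤? k →-dec 8 ℕ.≤? cutBound 4 k) (upTo 14)} _

-- Scrambles

meets? : ∀ (T E : VSet n) → Dec (Meets T E)
meets? {n} T E = map′ Any.satisfied (λ (v , hit) → lose (allV-complete v) hit)
  (Any.any? (λ v → (E v Bool.≟ true) ×-dec (T v Bool.≟ true)) (allV n))

hittingSet-or-avoidedEgg : ∀ (S : Scramble n) T →
  HittingSet S T ⊎ ∃ λ E → E ∈ eggs S × SubsetOf E (complement T)
hittingSet-or-avoidedEgg S T with all? (meets? T) (eggs S)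
... | yes hits = inj₁ (All.lookup hits)
... | no ¬hits with find (¬All⇒Any¬ (meets? T) (eggs S) ¬hits)
...   | E , E∈S , ¬meets = inj₂ (E , E∈S , avoids)
  where
  avoids : SubsetOf E (complement T)
  avoids v Ev with T v in Tv
  ... | true  = ⊥-elim (¬meets (v , Ev , Tv))
  ... | false = refl

order≤size⊎size⊎cut : ∀ (S : Scramble n) {k} A → OrderAtLeast S k →
  k ≤ size A ⊎ k ≤ size (complement A) ⊎ k ≤ cutSize A
order≤size⊎size⊎cut S A (hitting , cutting) with hittingSet-or-avoidedEgg S A
... | inj₁ hits = inj₁ (hitting A hits)
... | inj₂ outside with hittingSet-or-avoidedEgg S (complement A)
...   | inj₁ hits = inj₂ (inj₁ (hitting (complement A) hits))
...   | inj₂ (E , E∈S , E⊆A) =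
  inj₂ (inj₂ (cutting A ((E , E∈S , λ v Ev → trans (sym (Boolₚ.not-involutive (A v))) (E⊆A v Ev)) , outside)))

facet : VSet (suc n)
facet (b ∷ _) = b

no-scramble-of-order-9 : ∀ (S : Scramble 4) → OrderAtLeast S 9 → ⊥
no-scramble-of-order-9 S order with order≤size⊎size⊎cut S facet order
... | inj₁ 9≤8        = ℕₚ.<-irrefl refl 9≤8
... | inj₂ (inj₁ 9≤8) = ℕₚ.<-irrefl refl 9≤8
... | inj₂ (inj₂ 9≤8) = ℕₚ.<-irrefl refl 9≤8

path3 : V n → V n → V n → VSet n
path3 a b c v = eqᵇ a v ∨ eqᵇ b v ∨ eqᵇ c v

path3-members : ∀ (a b c v : V n) → path3 a b c v ≡ true → v ≡ a ⊎ v ≡ b ⊎ v ≡ c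
path3-members a b c v p with eqᵇ a v in av | eqᵇ b v in bv
... | true  | _     = inj₁ (sym (eqᵇ⇒≡ a v av))
... | false | true  = inj₂ (inj₁ (sym (eqᵇ⇒≡ b v bv)))
... | false | false = inj₂ (inj₂ (sym (eqᵇ⇒≡ c v p)))

path3-isEgg : ∀ (a b c : V n) → Adj a b → Adj b c → IsEgg (path3 a b c)
path3-isEgg a b c ab bc = (a , P∋a) , λ u v Pu Pv → toMiddle u Pu ++ʷ fromMiddle v Pv
  where
  P = path3 a b c
  P∋a : P a ≡ true
  P∋a rewrite eqᵇ-refl a = refl
  P∋b : P b ≡ true
  P∋b rewrite eqᵇ-refl b = Boolₚ.∨-zeroʳ (eqᵇ a b)
  P∋c : P c ≡ true
  P∋c rewrite eqᵇ-refl c = trans (cong (eqᵇ a c ∨_) (Boolₚ.∨-zeroʳ (eqᵇ b c))) (Boolₚ.∨-zeroʳ (eqᵇ a c))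
  toMiddle : ∀ u → P u ≡ true → WalkIn P u b
  toMiddle u Pu with path3-members a b c u Pu
  ... | inj₁ refl        = step P∋a ab (here P∋b)
  ... | inj₂ (inj₁ refl) = here P∋b
  ... | inj₂ (inj₂ refl) = step P∋c (Adj-sym {u = b} {c} bc) (here P∋b)
  fromMiddle : ∀ v → P v ≡ true → WalkIn P b v
  fromMiddle v Pv with path3-members a b c v Pv
  ... | inj₁ refl        = step P∋b (Adj-sym {u = a} {b} ab) (here P∋a)
  ... | inj₂ (inj₁ refl) = here P∋b
  ... | inj₂ (inj₂ refl) = step P∋b bc (here P∋c)

Meets-path3 : ∀ (T : VSet n) a b c → Meets T (path3 a b c) → (T a ∨ T b ∨ T c) ≡ true
Meets-path3 T a b c (v , Pv , Tv) with path3-members a b c v Pv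
... | inj₁ refl        = cong (λ t → t ∨ T b ∨ T c) Tv
... | inj₂ (inj₁ refl) = trans (cong (λ t → T a ∨ t ∨ T c) Tv) (Boolₚ.∨-zeroʳ (T a))
... | inj₂ (inj₂ refl) = trans (cong (λ t → T a ∨ T b ∨ t) Tv)
                               (trans (cong (T a ∨_) (Boolₚ.∨-zeroʳ (T b))) (Boolₚ.∨-zeroʳ (T a)))

rotate : V 2 → V 2
rotate (a ∷ b ∷ []) = b ∷ not a ∷ []

rotate-Adj : ∀ (u : V 2) → Adj u (rotate u)
rotate-Adj (true  ∷ true  ∷ []) = refl
rotate-Adj (true  ∷ false ∷ []) = refl
rotate-Adj (false ∷ true  ∷ []) = refl
rotate-Adj (false ∷ false ∷ []) = refl

face-Adj : ∀ x₁ x₂ (u : V 2) → Adj (x₁ ∷ x₂ ∷ u) (x₁ ∷ x₂ ∷ rotate u)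
face-Adj x₁ x₂ u = ∷-Adj x₁ (∷-Adj x₂ (rotate-Adj u))

faceEgg : V 4 → VSet 4
faceEgg (x₁ ∷ x₂ ∷ y) =
  path3 (x₁ ∷ x₂ ∷ rotate y) (x₁ ∷ x₂ ∷ rotate (rotate y)) (x₁ ∷ x₂ ∷ rotate (rotate (rotate y)))

faceScramble : Scramble 4
faceScramble = record { eggs = map faceEgg (allV 4) ; eggsAreEggs = isEgg }
  where
  isEgg : ∀ {E} → E ∈ map faceEgg (allV 4) → IsEgg E
  isEgg E∈ with ∈-map⁻ faceEgg {xs = allV 4} E∈
  ... | x₁ ∷ x₂ ∷ y , _ , refl =
    path3-isEgg (x₁ ∷ x₂ ∷ rotate y) (x₁ ∷ x₂ ∷ rotate (rotate y)) (x₁ ∷ x₂ ∷ rotate (rotate (rotate y)))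
                (face-Adj x₁ x₂ (rotate y)) (face-Adj x₁ x₂ (rotate (rotate y)))

everyBits : ∀ k → (Vec Bool k → Bool) → Bool
everyBits zero    f = f []
everyBits (suc k) f = everyBits k (f ∘ (true ∷_)) ∧ everyBits k (f ∘ (false ∷_))

everyBits-sound : ∀ k f → everyBits k f ≡ true → ∀ bs → f bs ≡ true
everyBits-sound zero    f ok []           = ok
everyBits-sound (suc k) f ok (true ∷ bs)  = everyBits-sound k _ (Boolₚ.∧-conicalˡ _ _ ok) bs
everyBits-sound (suc k) f ok (false ∷ bs) = everyBits-sound k _ (Boolₚ.∧-conicalʳ _ _ ok) bs

subsetQ₂ : Vec Bool 4 → VSet 2
subsetQ₂ (b₁₁ ∷ _   ∷ _   ∷ _   ∷ []) (true  ∷ true  ∷ []) = b₁₁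
subsetQ₂ (_   ∷ b₁₀ ∷ _   ∷ _   ∷ []) (true  ∷ false ∷ []) = b₁₀
subsetQ₂ (_   ∷ _   ∷ b₀₁ ∷ _   ∷ []) (false ∷ true  ∷ []) = b₀₁
subsetQ₂ (_   ∷ _   ∷ _   ∷ b₀₀ ∷ []) (false ∷ false ∷ []) = b₀₀

hitsFourCycle : VSet 2 → Bool
hitsFourCycle T = all (λ y → T (rotate y) ∨ T (rotate (rotate y)) ∨ T (rotate (rotate (rotate y)))) (allV 2)

fourCycle-hitting : ∀ (T : VSet 2) →
  (∀ y → (T (rotate y) ∨ T (rotate (rotate y)) ∨ T (rotate (rotate (rotate y)))) ≡ true) → 2 ≤ size T
fourCycle-hitting T hits =
  subst (2 ≤_) (size-cong S≗T) (ℕₚ.≤ᵇ⇒≤ 2 (size S) (Equivalence.from Boolₚ.T-≡ two≤ᵇ))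
  where
  -- S is T tabulated, so the exhaustive check over all sixteen bit vectors applies to it.
  values : Vec Bool 4
  values = T (true ∷ true ∷ []) ∷ T (true ∷ false ∷ []) ∷ T (false ∷ true ∷ []) ∷ T (false ∷ false ∷ []) ∷ []
  S : VSet 2
  S = subsetQ₂ values
  S≗T : ∀ v → S v ≡ T v
  S≗T (true  ∷ true  ∷ []) = refl
  S≗T (true  ∷ false ∷ []) = refl
  S≗T (false ∷ true  ∷ []) = refl
  S≗T (false ∷ false ∷ []) = refl
  hitsS : ∀ y → (S (rotate y) ∨ S (rotate (rotate y)) ∨ S (rotate (rotate (rotate y)))) ≡ true
  hitsS y rewrite S≗T (rotate y) | S≗T (rotate (rotate y)) | S≗T (rotate (rotate (rotate y))) = hits y
  two≤ᵇ : (2 ℕ.≤ᵇ size S) ≡ true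
  two≤ᵇ = subst (λ h → (not h ∨ (2 ℕ.≤ᵇ size S)) ≡ true)
    (cong₂ _∧_ (hitsS (true ∷ true ∷ [])) (cong₂ _∧_ (hitsS (true ∷ false ∷ []))
      (cong₂ _∧_ (hitsS (false ∷ true ∷ [])) (cong₂ _∧_ (hitsS (false ∷ false ∷ [])) refl))))
    (everyBits-sound 4 (λ bs → not (hitsFourCycle (subsetQ₂ bs)) ∨ (2 ℕ.≤ᵇ size (subsetQ₂ bs))) refl values)

faceScramble-hitting : ∀ T → HittingSet faceScramble T → 8 ≤ size T
faceScramble-hitting T hits = begin
  8
    ≤⟨ ℕₚ.+-mono-≤ (ℕₚ.+-mono-≤ (face true true) (face true false))
                   (ℕₚ.+-mono-≤ (face false true) (face false false)) ⟩
  (size (face-of true true) + size (face-of true false)) + (size (face-of false true) + size (face-of false false))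
    ≡⟨ cong₂ _+_ (size-suc (T ∘ (true ∷_))) (size-suc (T ∘ (false ∷_))) ⟨
  size (T ∘ (true ∷_)) + size (T ∘ (false ∷_))
    ≡⟨ size-suc T ⟨
  size T  ∎
  where
  open ℕₚ.≤-Reasoning
  face-of : Bool → Bool → VSet 2
  face-of x₁ x₂ y = T (x₁ ∷ x₂ ∷ y)
  face : ∀ x₁ x₂ → 2 ≤ size (face-of x₁ x₂)
  face x₁ x₂ = fourCycle-hitting (face-of x₁ x₂) λ y →
    Meets-path3 T _ _ _ (hits (∈-map⁺ faceEgg (allV-complete (x₁ ∷ x₂ ∷ y))))

faceEgg-sizes : All (λ E → size E ≡ 3) (eggs faceScramble)
faceEgg-sizes = toWitness {a? = all? (λ E → size E ℕ.≟ 3) (eggs faceScramble)} _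

contains-egg⇒3≤size : ∀ {E} A → E ∈ eggs faceScramble → SubsetOf E A → 3 ≤ size A
contains-egg⇒3≤size A E∈ E⊆A = subst (_≤ size A) (All.lookup faceEgg-sizes E∈) (size-mono E⊆A)

avoids-egg⇒size≤13 : ∀ {E} A → E ∈ eggs faceScramble → SubsetOf E (complement A) → size A ≤ 13
avoids-egg⇒size≤13 A E∈ E⊆Aᶜ = ℕₚ.+-cancelʳ-≤ 3 (size A) 13
  (ℕₚ.≤-trans (ℕₚ.+-monoʳ-≤ (size A) (contains-egg⇒3≤size (complement A) E∈ E⊆Aᶜ))
              (ℕₚ.≤-reflexive (size+size-complement A)))

faceScramble-eggCut : ∀ A → EggCut faceScramble A → 8 ≤ cutSize A
faceScramble-eggCut A ((E , E∈ , E⊆A) , (E′ , E′∈ , E′⊆Aᶜ)) =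
  isoperimetric-Q₄ A (contains-egg⇒3≤size A E∈ E⊆A) (avoids-egg⇒size≤13 A E′∈ E′⊆Aᶜ)

faceScramble-order : OrderAtLeast faceScramble 8
faceScramble-order = faceScramble-hitting , faceScramble-eggCut

scrambleNumber-Q₄ : ScrambleNumberIs 4 8
scrambleNumber-Q₄ = (faceScramble , faceScramble-order) , no-scramble-of-order-9

-- Chip firing

laplacian : (V n → ℤ) → Divisor n
laplacian {n} g w = ∑ℤ (λ u → if adjᵇ w u then g w ℤ.- g u else + 0) (allV n)

𝟙 : VSet n → V n → ℤ
𝟙 U u = if U u then + 1 else + 0

laplacian-𝟙-inside : ∀ (U : VSet n) u → U u ≡ true → laplacian (𝟙 U) u ≡ + outDegree U u
laplacian-𝟙-inside {n} U u Uu =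
  trans (ℤΣ.∑-cong (allV n) leaving) (∑ℤ-+ (λ w → ⟦ not (U w) ∧ adjᵇ u w ⟧) (allV n))
  where
  leaving : ∀ w → (if adjᵇ u w then 𝟙 U u ℤ.- 𝟙 U w else + 0) ≡ + ⟦ not (U w) ∧ adjᵇ u w ⟧
  leaving w rewrite Uu with U w | adjᵇ u w
  ... | true  | true  = refl
  ... | true  | false = refl
  ... | false | true  = refl
  ... | false | false = refl

laplacian-𝟙-outside : ∀ (U : VSet n) u → U u ≡ false → laplacian (𝟙 U) u ≡ ℤ.- (+ inDegree U u)
laplacian-𝟙-outside {n} U u Uu = begin
  ∑ℤ (λ w → if adjᵇ u w then 𝟙 U u ℤ.- 𝟙 U w else + 0) (allV n)
    ≡⟨ ℤΣ.∑-cong (allV n) entering ⟩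
  ∑ℤ (λ w → ℤ.- (+ ⟦ U w ∧ adjᵇ u w ⟧)) (allV n)
    ≡⟨ ∑ℤ-neg (λ w → + ⟦ U w ∧ adjᵇ u w ⟧) (allV n) ⟩
  ℤ.- ∑ℤ (λ w → + ⟦ U w ∧ adjᵇ u w ⟧) (allV n)
    ≡⟨ cong ℤ.-_ (∑ℤ-+ (λ w → ⟦ U w ∧ adjᵇ u w ⟧) (allV n)) ⟩
  ℤ.- (+ inDegree U u)  ∎
  where
  open ≡-Reasoning
  entering : ∀ w → (if adjᵇ u w then 𝟙 U u ℤ.- 𝟙 U w else + 0) ≡ ℤ.- (+ ⟦ U w ∧ adjᵇ u w ⟧)
  entering w rewrite Uu with U w | adjᵇ u w
  ... | true  | true  = refl
  ... | true  | false = refl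
  ... | false | true  = refl
  ... | false | false = refl

fire≡-laplacian : ∀ (X : Divisor n) v w → fire X v w ≡ X w ℤ.- laplacian (𝟙 (eqᵇ v)) w
fire≡-laplacian {n} X v w = by-cases (eqᵇ v w) refl
  where
  open ≡-Reasoning
  firing : ∀ {b} → eqᵇ v w ≡ b → fire X v w ≡ (if b then X w ℤ.- + valence v else X w ℤ.+ + edges v w)
  firing = cong (λ b → if b then X w ℤ.- + valence v else X w ℤ.+ + edges v w)
  outDegree≡valence : outDegree (eqᵇ v) v ≡ valence v
  outDegree≡valence = begin
    count (λ u → not (eqᵇ v u) ∧ adjᵇ v u) (allV n)
      ≡⟨ ℕΣ.∑-cong (allV n) drop-≢ ⟩
    count (adjᵇ v) (allV n)
      ≡⟨ length-filterᵇ (adjᵇ v) (allV n) ⟨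
    valence v  ∎
    where
    drop-≢ : ∀ u → ⟦ not (eqᵇ v u) ∧ adjᵇ v u ⟧ ≡ ⟦ adjᵇ v u ⟧
    drop-≢ u with adjᵇ v u in adj
    ... | true  rewrite adjᵇ⇒¬eqᵇ v u adj = refl
    ... | false = cong ⟦_⟧ (Boolₚ.∧-zeroʳ (not (eqᵇ v u)))
  inDegree≡edges : inDegree (eqᵇ v) w ≡ edges v w
  inDegree≡edges = begin
    count (λ u → eqᵇ v u ∧ adjᵇ w u) (allV n)
      ≡⟨ ℕΣ.∑-cong (allV n) (λ u → cong ⟦_⟧ (Boolₚ.∧-comm (eqᵇ v u) (adjᵇ w u))) ⟩
    count (λ u → adjᵇ w u ∧ eqᵇ v u) (allV n)
      ≡⟨ count-∧eqᵇ (adjᵇ w) v ⟩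
    ⟦ adjᵇ w v ⟧
      ≡⟨ cong ⟦_⟧ (adjᵇ-sym w v) ⟩
    edges v w  ∎
  by-cases : ∀ b → eqᵇ v w ≡ b → fire X v w ≡ X w ℤ.- laplacian (𝟙 (eqᵇ v)) w
  by-cases true  v≡w with refl ← eqᵇ⇒≡ v w v≡w = begin
    fire X v v                                ≡⟨ firing v≡w ⟩
    X v ℤ.- + valence v                       ≡⟨ cong (λ k → X v ℤ.- + k) outDegree≡valence ⟨
    X v ℤ.- + outDegree (eqᵇ v) v             ≡⟨ cong (ℤ._-_ (X v)) (laplacian-𝟙-inside (eqᵇ v) v v≡w) ⟨
    X v ℤ.- laplacian (𝟙 (eqᵇ v)) v           ∎
  by-cases false v≢w = begin
    fire X v w                                ≡⟨ firing v≢w ⟩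
    X w ℤ.+ + edges v w                       ≡⟨ cong (ℤ._+_ (X w)) (ℤₚ.neg-involutive _) ⟨
    X w ℤ.- ℤ.- (+ edges v w)                 ≡⟨ cong (λ k → X w ℤ.- ℤ.- (+ k)) inDegree≡edges ⟨
    X w ℤ.- ℤ.- (+ inDegree (eqᵇ v) w)        ≡⟨ cong (ℤ._-_ (X w)) (laplacian-𝟙-outside (eqᵇ v) w v≢w) ⟨
    X w ℤ.- laplacian (𝟙 (eqᵇ v)) w           ∎

laplacian-0 : ∀ (w : V n) → laplacian (λ _ → + 0) w ≡ + 0
laplacian-0 {n} w = trans (ℤΣ.∑-cong (allV n) flat) (ℤΣ.∑-ε (allV n))
  where
  flat : ∀ u → (if adjᵇ w u then + 0 ℤ.- + 0 else + 0) ≡ + 0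
  flat u with adjᵇ w u
  ... | true  = refl
  ... | false = refl

laplacian-+ : ∀ (g h : V n → ℤ) w → laplacian (λ u → g u ℤ.+ h u) w ≡ laplacian g w ℤ.+ laplacian h w
laplacian-+ {n} g h w = trans (ℤΣ.∑-cong (allV n) split) (ℤΣ.∑-∙ _ _ (allV n))
  where
  split : ∀ u → (if adjᵇ w u then (g w ℤ.+ h w) ℤ.- (g u ℤ.+ h u) else + 0)
              ≡ (if adjᵇ w u then g w ℤ.- g u else + 0) ℤ.+ (if adjᵇ w u then h w ℤ.- h u else + 0)
  split u with adjᵇ w u
  ... | true  = ring (g w) (h w) (g u) (h u)
    where
    ring : ∀ a b c d → (a ℤ.+ b) ℤ.- (c ℤ.+ d) ≡ (a ℤ.- c) ℤ.+ (b ℤ.- d)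
    ring = solve-∀
  ... | false = refl

laplacian-neg : ∀ (g : V n → ℤ) w → laplacian (λ u → ℤ.- g u) w ≡ ℤ.- laplacian g w
laplacian-neg {n} g w = trans (ℤΣ.∑-cong (allV n) negate) (∑ℤ-neg _ (allV n))
  where
  negate : ∀ u → (if adjᵇ w u then ℤ.- g w ℤ.- ℤ.- g u else + 0) ≡ ℤ.- (if adjᵇ w u then g w ℤ.- g u else + 0)
  negate u with adjᵇ w u
  ... | true  = ring (g w) (g u)
    where
    ring : ∀ a b → ℤ.- a ℤ.- ℤ.- b ≡ ℤ.- (a ℤ.- b)
    ring = solve-∀
  ... | false = refl

laplacian-sum : ∀ (g : V n → ℤ) → ∑ℤ (laplacian g) (allV n) ≡ + 0
laplacian-sum {n} g = begin
  ∑ℤ (laplacian g) (allV n)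
    ≡⟨ ℤΣ.∑-cong (allV n) (λ w → trans (ℤΣ.∑-cong (allV n) (split w)) (split-∑ w)) ⟩
  ∑ℤ (λ w → out w ℤ.- in′ w) (allV n)
    ≡⟨ trans (ℤΣ.∑-∙ out (λ w → ℤ.- in′ w) (allV n)) (cong (ℤ._+_ (∑ℤ out (allV n))) (∑ℤ-neg in′ (allV n))) ⟩
  ∑ℤ out (allV n) ℤ.- ∑ℤ in′ (allV n)
    ≡⟨ cong (λ s → ∑ℤ out (allV n) ℤ.- s) in′≡out ⟩
  ∑ℤ out (allV n) ℤ.- ∑ℤ out (allV n)
    ≡⟨ ℤₚ.+-inverseʳ (∑ℤ out (allV n)) ⟩
  + 0  ∎
  where
  open ≡-Reasoning
  out in′ : V n → ℤ
  out w = ∑ℤ (λ u → if adjᵇ w u then g w else + 0) (allV n)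
  in′ w = ∑ℤ (λ u → if adjᵇ w u then g u else + 0) (allV n)
  split : ∀ w u → (if adjᵇ w u then g w ℤ.- g u else + 0)
                ≡ (if adjᵇ w u then g w else + 0) ℤ.+ ℤ.- (if adjᵇ w u then g u else + 0)
  split w u with adjᵇ w u
  ... | true  = refl
  ... | false = refl
  split-∑ : ∀ w → ∑ℤ (λ u → (if adjᵇ w u then g w else + 0) ℤ.+ ℤ.- (if adjᵇ w u then g u else + 0)) (allV n)
                ≡ out w ℤ.- in′ w
  split-∑ w = trans (ℤΣ.∑-∙ _ _ (allV n)) (cong (ℤ._+_ (out w)) (∑ℤ-neg _ (allV n)))
  in′≡out : ∑ℤ in′ (allV n) ≡ ∑ℤ out (allV n)
  in′≡out = trans (ℤΣ.∑-comm (λ w u → if adjᵇ w u then g u else + 0) (allV n) (allV n))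
                  (ℤΣ.∑-cong (allV n) λ u → ℤΣ.∑-cong (allV n) λ w → cong (λ b → if b then g u else + 0) (adjᵇ-sym w u))

-- Linear equivalence.  Equiv only fires forwards; ∼ allows any integer script, so it is an
-- equivalence relation containing Equiv.
record _∼_ (X Y : Divisor n) : Set where
  constructor mk∼
  field
    script : V n → ℤ
    fired  : ∀ w → Y w ≡ X w ℤ.- laplacian script w

∼-refl : ∀ (X : Divisor n) → X ∼ X
∼-refl X = mk∼ (λ _ → + 0) λ w → sym (trans (cong (ℤ._-_ (X w)) (laplacian-0 w)) (ℤₚ.+-identityʳ (X w)))

∼-trans : ∀ {X Y Z : Divisor n} → X ∼ Y → Y ∼ Z → X ∼ Z
∼-trans {X = X} {Y} {Z} (mk∼ g Y≡) (mk∼ h Z≡) = mk∼ (λ u → g u ℤ.+ h u) λ w → begin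
  Z w                                            ≡⟨ Z≡ w ⟩
  Y w ℤ.- laplacian h w                          ≡⟨ cong (λ y → y ℤ.- laplacian h w) (Y≡ w) ⟩
  (X w ℤ.- laplacian g w) ℤ.- laplacian h w      ≡⟨ ring (X w) (laplacian g w) (laplacian h w) ⟩
  X w ℤ.- (laplacian g w ℤ.+ laplacian h w)      ≡⟨ cong (ℤ._-_ (X w)) (laplacian-+ g h w) ⟨
  X w ℤ.- laplacian (λ u → g u ℤ.+ h u) w        ∎
  where
  open ≡-Reasoning
  ring : ∀ x a b → (x ℤ.- a) ℤ.- b ≡ x ℤ.- (a ℤ.+ b)
  ring = solve-∀

∼-sym : ∀ {X Y : Divisor n} → X ∼ Y → Y ∼ X
∼-sym {X = X} {Y} (mk∼ g Y≡) = mk∼ (λ u → ℤ.- g u) λ w → begin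
  X w                                            ≡⟨ ring (X w) (laplacian g w) ⟩
  (X w ℤ.- laplacian g w) ℤ.- ℤ.- laplacian g w  ≡⟨ cong₂ ℤ._-_ (Y≡ w) (laplacian-neg g w) ⟨
  Y w ℤ.- laplacian (λ u → ℤ.- g u) w            ∎
  where
  open ≡-Reasoning
  ring : ∀ x a → x ≡ (x ℤ.- a) ℤ.- ℤ.- a
  ring = solve-∀

Fires⇒∼ : ∀ {X Y : Divisor n} → Fires X Y → X ∼ Y
Fires⇒∼ {X = X} (v , Y≡) = mk∼ (𝟙 (eqᵇ v)) λ w → trans (Y≡ w) (fire≡-laplacian X v w)

Equiv⇒∼ : ∀ {X Y : Divisor n} → Equiv X Y → X ∼ Y
Equiv⇒∼ ε        = ∼-refl _
Equiv⇒∼ (f ◅ fs) = ∼-trans (Fires⇒∼ f) (Equiv⇒∼ fs)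

minusChip-∼ : ∀ {X Y : Divisor n} q → X ∼ Y → minusChip X q ∼ minusChip Y q
minusChip-∼ {X = X} {Y} q (mk∼ g Y≡) = mk∼ g λ w → chip w (eqᵇ q w)
  where
  chip : ∀ w b → (if b then Y w ℤ.- + 1 else Y w) ≡ (if b then X w ℤ.- + 1 else X w) ℤ.- laplacian g w
  chip w true  = trans (cong (λ y → y ℤ.- + 1) (Y≡ w)) (ring (X w) (laplacian g w))
    where
    ring : ∀ x a → (x ℤ.- a) ℤ.- + 1 ≡ (x ℤ.- + 1) ℤ.- a
    ring = solve-∀
  chip w false = Y≡ w

minusChip∼⇒∼+𝟙 : ∀ {X Y : Divisor n} q → minusChip X q ∼ Y → X ∼ (λ w → Y w ℤ.+ 𝟙 (eqᵇ q) w)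
minusChip∼⇒∼+𝟙 {X = X} {Y} q (mk∼ g fired) = mk∼ g λ w → chip w (eqᵇ q w) (fired w)
  where
  chip : ∀ w b → Y w ≡ (if b then X w ℤ.- + 1 else X w) ℤ.- laplacian g w →
         Y w ℤ.+ (if b then + 1 else + 0) ≡ X w ℤ.- laplacian g w
  chip w true  Y≡ = trans (cong (ℤ._+ + 1) Y≡) (ring (X w) (laplacian g w))
    where
    ring : ∀ x a → (x ℤ.- + 1) ℤ.- a ℤ.+ + 1 ≡ x ℤ.- a
    ring = solve-∀
  chip w false Y≡ = trans (ℤₚ.+-identityʳ (Y w)) Y≡

∼-respʳ : ∀ {X Y Y′ : Divisor n} → (∀ w → Y w ≡ Y′ w) → X ∼ Y → X ∼ Y′
∼-respʳ Y≗Y′ (mk∼ g fired) = mk∼ g λ w → trans (sym (Y≗Y′ w)) (fired w)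

∼-degree : ∀ {X Y : Divisor n} → X ∼ Y → degree Y ≡ degree X
∼-degree {n} {X} {Y} (mk∼ g Y≡) = begin
  ∑ℤ Y (allV n)
    ≡⟨ ℤΣ.∑-cong (allV n) Y≡ ⟩
  ∑ℤ (λ w → X w ℤ.- laplacian g w) (allV n)
    ≡⟨ ℤΣ.∑-∙ X (λ w → ℤ.- laplacian g w) (allV n) ⟩
  ∑ℤ X (allV n) ℤ.+ ∑ℤ (λ w → ℤ.- laplacian g w) (allV n)
    ≡⟨ cong (ℤ._+_ (∑ℤ X (allV n))) (trans (∑ℤ-neg (laplacian g) (allV n)) (cong ℤ.-_ (laplacian-sum g))) ⟩
  ∑ℤ X (allV n) ℤ.+ + 0
    ≡⟨ ℤₚ.+-identityʳ _ ⟩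
  ∑ℤ X (allV n)  ∎
  where open ≡-Reasoning

outDegree-level≤laplacian : ∀ (g : V n → ℤ) c u → (∀ w → g w ℤ.≤ c) → g u ≡ c →
  + outDegree (λ w → c ℤ.≤ᵇ g w) u ℤ.≤ laplacian g u
outDegree-level≤laplacian {n} g c u g≤c gu≡c =
  subst (ℤ._≤ laplacian g u) (∑ℤ-+ (λ w → ⟦ not (c ℤ.≤ᵇ g w) ∧ adjᵇ u w ⟧) (allV n))
        (∑ℤ-mono (allV n) pointwise)
  where
  pointwise : ∀ w → + ⟦ not (c ℤ.≤ᵇ g w) ∧ adjᵇ u w ⟧ ℤ.≤ (if adjᵇ u w then g u ℤ.- g w else + 0)
  pointwise w with c ℤ.≤ᵇ g w in c≤gw | adjᵇ u w
  ... | true  | false = ℤₚ.≤-refl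
  ... | false | false = ℤₚ.≤-refl
  ... | true  | true  = ℤₚ.i≤j⇒0≤j-i (subst (g w ℤ.≤_) (sym gu≡c) (g≤c w))
  ... | false | true  = subst (+ 1 ℤ.≤_) (ring (g u) (g w)) (ℤₚ.+-monoʳ-≤ (+ 1) (ℤₚ.i≤j⇒0≤j-i gw+1≤gu))
    where
    gw+1≤gu : ℤ.suc (g w) ℤ.≤ g u
    gw+1≤gu = subst (ℤ.suc (g w) ℤ.≤_) (sym gu≡c)
      (ℤₚ.i<j⇒suc[i]≤j (ℤₚ.≰⇒> λ c≤gw′ → subst Bool.T c≤gw (ℤₚ.≤⇒≤ᵇ c≤gw′)))
    ring : ∀ x y → + 1 ℤ.+ (x ℤ.- (+ 1 ℤ.+ y)) ≡ x ℤ.- y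
    ring = solve-∀

⌜_⌝ : (V n → ℕ) → Divisor n
⌜ N ⌝ v = + N v

degree-⌜⌝ : ∀ (N : V n → ℕ) → degree ⌜ N ⌝ ≡ + ∑ℕ N (allV n)
degree-⌜⌝ {n} N = ∑ℤ-+ N (allV n)

∼-∑ℕ : ∀ {N M : V n → ℕ} → ⌜ N ⌝ ∼ ⌜ M ⌝ → ∑ℕ M (allV n) ≡ ∑ℕ N (allV n)
∼-∑ℕ {N = N} {M} N∼M = ℤₚ.+-injective (trans (sym (degree-⌜⌝ M)) (trans (∼-degree N∼M) (degree-⌜⌝ N)))

PositiveRank∼ : Divisor n → Set
PositiveRank∼ {n} D = ∀ (q : V n) → ∃ λ D′ → minusChip D q ∼ D′ × Effective D′

PositiveRank⇒PositiveRank∼ : ∀ {D : Divisor n} → PositiveRank D → PositiveRank∼ D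
PositiveRank⇒PositiveRank∼ rank q with rank q
... | D′ , D-q→D′ , effective = D′ , Equiv⇒∼ D-q→D′ , effective

PositiveRank∼-resp-∼ : ∀ {X Y : Divisor n} → X ∼ Y → PositiveRank∼ X → PositiveRank∼ Y
PositiveRank∼-resp-∼ X∼Y rank q with rank q
... | D′ , X-q∼D′ , effective = D′ , ∼-trans (∼-sym (minusChip-∼ q X∼Y)) X-q∼D′ , effective

minusChip≤ : ∀ (N : V n → ℕ) q u → minusChip ⌜ N ⌝ q u ℤ.≤ + N u
minusChip≤ N q u with eqᵇ q u
... | true  = ℤₚ.i-j≤i (+ N u) (+ 1)
... | false = ℤₚ.≤-refl

minusChip-at : ∀ (N : V n → ℕ) q → minusChip ⌜ N ⌝ q q ≡ + N q ℤ.- + 1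
minusChip-at N q = cong (λ b → if b then + N q ℤ.- + 1 else + N q) (eqᵇ-refl q)

maximum : ∀ (g : V n → ℤ) (v : V n) → ∃ λ top → ∀ u → g u ℤ.≤ g top
maximum {n} g v = argmax g v (allV n) , λ u → All.lookup (f[xs]≤f[argmax] {f = g} v (allV n)) (allV-complete u)

-- Firing sets and energy

Legal : VSet n → (V n → ℕ) → Set
Legal U N = ∀ u → U u ≡ true → outDegree U u ≤ N u

fireSet : VSet n → (V n → ℕ) → V n → ℕ
fireSet U N u = if U u then N u ∸ outDegree U u else N u + inDegree U u

fireSet-∼ : ∀ {U : VSet n} {N} → Legal U N → ⌜ N ⌝ ∼ ⌜ fireSet U N ⌝
fireSet-∼ {U = U} {N} legal = mk∼ (𝟙 U) λ u → by-cases u (U u) refl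
  where
  open ≡-Reasoning
  firing : ∀ u {b} → U u ≡ b →
    ⌜ fireSet U N ⌝ u ≡ + (if b then N u ∸ outDegree U u else N u + inDegree U u)
  firing u = cong (λ b → + (if b then N u ∸ outDegree U u else N u + inDegree U u))
  by-cases : ∀ u b → U u ≡ b → ⌜ fireSet U N ⌝ u ≡ + N u ℤ.- laplacian (𝟙 U) u
  by-cases u true Uu = begin
    ⌜ fireSet U N ⌝ u                  ≡⟨ firing u Uu ⟩
    + (N u ∸ outDegree U u)            ≡⟨ ℤₚ.⊖-≥ (legal u Uu) ⟨
    N u ⊖ outDegree U u                ≡⟨ ℤₚ.m-n≡m⊖n (N u) (outDegree U u) ⟨
    + N u ℤ.- + outDegree U u          ≡⟨ cong (ℤ._-_ (+ N u)) (laplacian-𝟙-inside U u Uu) ⟨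
    + N u ℤ.- laplacian (𝟙 U) u        ∎
  by-cases u false Uu = begin
    ⌜ fireSet U N ⌝ u                  ≡⟨ firing u Uu ⟩
    + N u ℤ.+ + inDegree U u           ≡⟨ cong (ℤ._+_ (+ N u)) (ℤₚ.neg-involutive (+ inDegree U u)) ⟨
    + N u ℤ.- ℤ.- (+ inDegree U u)     ≡⟨ cong (ℤ._-_ (+ N u)) (laplacian-𝟙-outside U u Uu) ⟨
    + N u ℤ.- laplacian (𝟙 U) u        ∎

energy : (V n → ℕ) → ℕ
energy {n} N = ∑ℕ (λ u → N u * N u) (allV n)

weight : VSet n → ℕ
weight {n} U = ∑ℕ (λ u → if U u then outDegree U u * suc (outDegree U u) else 0) (allV n)

energy-inside : ∀ m o → o ≤ m → (m ∸ o) * (m ∸ o) + o * suc o + o ≤ m * m + (m + m) + 0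
energy-inside m o o≤m = subst (λ k → (k ∸ o) * (k ∸ o) + o * suc o + o ≤ k * k + (k + k) + 0)
                              (ℕₚ.m∸n+n≡m o≤m) (bound (m ∸ o))
  where
  expand : ∀ l o → (l + o) * (l + o) + ((l + o) + (l + o)) + 0 ≡ l * l + o * (1 + o) + o + (2 * l * o + 2 * l)
  expand = solve-∀ℕ
  bound : ∀ l → (l + o ∸ o) * (l + o ∸ o) + o * suc o + o ≤ (l + o) * (l + o) + ((l + o) + (l + o)) + 0
  bound l rewrite ℕₚ.m+n∸n≡m l o = ℕₚ.≤-trans (ℕₚ.m≤m+n _ (2 * l * o + 2 * l)) (ℕₚ.≤-reflexive (sym (expand l o)))

energy-outside : ∀ m i → i ≤ 1 → (m + i) * (m + i) + 0 + 0 ≤ m * m + (m + m) + i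
energy-outside m zero    _ = ℕₚ.≤-trans (ℕₚ.m≤m+n _ (m + m)) (ℕₚ.≤-reflexive (expand m))
  where
  expand : ∀ m → (m + 0) * (m + 0) + 0 + 0 + (m + m) ≡ m * m + (m + m) + 0
  expand = solve-∀ℕ
energy-outside m (suc zero) _ = ℕₚ.≤-reflexive (expand m)
  where
  expand : ∀ m → (m + 1) * (m + 1) + 0 + 0 ≡ m * m + (m + m) + 1
  expand = solve-∀ℕ
energy-outside m (suc (suc i)) (s≤s ())

-- Vertexwise, (n − o)² + o(o + 1) + o ≤ n² + 2n on U (where o ≤ n) and (n + i)² ≤ n² + 2n + i
-- off U (where i ≤ 1); summed, the extra o's and i's are the two counts of the cut of U.
energy-fireSet : ∀ {U : VSet n} {N} → Legal U N → (∀ u → U u ≡ false → inDegree U u ≤ 1) →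
  energy (fireSet U N) + weight U ≤ energy N + (∑ℕ N (allV n) + ∑ℕ N (allV n))
energy-fireSet {n} {U} {N} legal entering≤1 = ℕₚ.+-cancelʳ-≤ (cutSize U) _ _ (begin
  energy N′ + weight U + cutSize U
    ≡⟨ cong₂ _+_ (sym (ℕΣ.∑-∙ _ _ (allV n))) (cutSize≡∑outDegree U) ⟩
  ∑ℕ (λ u → N′ u * N′ u + gain u) (allV n) + ∑ℕ leave (allV n)
    ≡⟨ ℕΣ.∑-∙ _ leave (allV n) ⟨
  ∑ℕ (λ u → N′ u * N′ u + gain u + leave u) (allV n)
    ≤⟨ ∑ℕ-mono (allV n) pointwise ⟩
  ∑ℕ (λ u → N u * N u + (N u + N u) + enter u) (allV n)
    ≡⟨ trans (ℕΣ.∑-∙ _ enter (allV n)) (cong (_+ ∑ℕ enter (allV n)) (ℕΣ.∑-∙ _ _ (allV n))) ⟩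
  energy N + ∑ℕ (λ u → N u + N u) (allV n) + ∑ℕ enter (allV n)
    ≡⟨ cong₂ (λ s t → energy N + s + t) (ℕΣ.∑-∙ N N (allV n)) enter≡cut ⟩
  energy N + (∑ℕ N (allV n) + ∑ℕ N (allV n)) + cutSize U  ∎)
  where
  open ℕₚ.≤-Reasoning
  N′ : V n → ℕ
  N′ = fireSet U N
  gain leave enter : V n → ℕ
  gain u  = if U u then outDegree U u * suc (outDegree U u) else 0
  leave u = if U u then outDegree U u else 0
  enter u = if U u then 0 else inDegree U u
  pointwise : ∀ u → N′ u * N′ u + gain u + leave u ≤ N u * N u + (N u + N u) + enter u
  pointwise u with U u in Uu
  ... | true  = energy-inside (N u) (outDegree U u) (legal u Uu)
  ... | false = energy-outside (N u) (inDegree U u) (entering≤1 u Uu)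
  enter≡cut : ∑ℕ enter (allV n) ≡ cutSize U
  enter≡cut = begin-equality
    ∑ℕ enter (allV n)
      ≡⟨ ℕΣ.∑-cong (allV n) flip ⟩
    ∑ℕ (λ u → if complement U u then outDegree (complement U) u else 0) (allV n)
      ≡⟨ cutSize≡∑outDegree (complement U) ⟨
    cutSize (complement U)
      ≡⟨ cutSize-complement U ⟩
    cutSize U  ∎
    where
    flip : ∀ u → enter u ≡ (if complement U u then outDegree (complement U) u else 0)
    flip u with U u
    ... | true  = refl
    ... | false = ℕΣ.∑-cong (allV n) (λ w → cong (λ b → ⟦ b ∧ adjᵇ u w ⟧) (sym (Boolₚ.not-involutive (U w))))

fireSet-decreases-energy : ∀ {U : VSet n} {N} → Legal U N → (∀ u → U u ≡ false → inDegree U u ≤ 1) →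
  ∑ℕ N (allV n) + ∑ℕ N (allV n) < weight U → energy (fireSet U N) < energy N
fireSet-decreases-energy {n} {U} {N} legal entering≤1 heavy = ℕₚ.+-cancelʳ-≤ s (suc (energy (fireSet U N))) (energy N) (begin
  suc (energy (fireSet U N)) + s   ≡⟨ ℕₚ.+-suc (energy (fireSet U N)) s ⟨
  energy (fireSet U N) + suc s     ≤⟨ ℕₚ.+-monoʳ-≤ (energy (fireSet U N)) heavy ⟩
  energy (fireSet U N) + weight U  ≤⟨ energy-fireSet legal entering≤1 ⟩
  energy N + s                     ∎)
  where
  open ℕₚ.≤-Reasoning
  s = ∑ℕ N (allV n) + ∑ℕ N (allV n)

-- The gonality of Q₄

effective? : ∀ (D : Divisor n) → Dec (Effective D)
effective? D = all-V? (λ v → + 0 ℤₚ.≤? D v)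

fireAll : List (V n) → Divisor n → Divisor n
fireAll []       X = X
fireAll (v ∷ vs) X = fireAll vs (fire X v)

fireAll-Equiv : ∀ vs (X : Divisor n) → Equiv X (fireAll vs X)
fireAll-Equiv []       X = ε
fireAll-Equiv (v ∷ vs) X = (v , λ w → refl) ◅ fireAll-Equiv vs (fire X v)

facetDivisor : Divisor 4
facetDivisor = 𝟙 facet

facetDivisor-rank : PositiveRank facetDivisor
facetDivisor-rank q with facet q in q∈facet
... | true  = minusChip facetDivisor q , ε , on-facet q q∈facet
  where
  on-facet : ∀ q → facet q ≡ true → Effective (minusChip facetDivisor q)
  on-facet = toWitness {a? = all-V? λ q → (facet q Bool.≟ true) →-dec effective? (minusChip facetDivisor q)} _
... | false =
  fireAll facetVertices (minusChip facetDivisor q) , fireAll-Equiv facetVertices _ , off-facet q q∈facet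
  where
  facetVertices : List (V 4)
  facetVertices = filterᵇ facet (allV 4)
  off-facet : ∀ q → facet q ≡ false → Effective (fireAll facetVertices (minusChip facetDivisor q))
  off-facet = toWitness {a? = all-V? λ q → (facet q Bool.≟ false) →-dec
                                 effective? (fireAll facetVertices (minusChip facetDivisor q))} _

pair : V n → V n → VSet n
pair v w u = eqᵇ v u ∨ eqᵇ w u

pair-members : ∀ (v w u : V n) → pair v w u ≡ true → u ≡ v ⊎ u ≡ w
pair-members v w u u∈pair with eqᵇ v u in v≡u
... | true  = inj₁ (sym (eqᵇ⇒≡ v u v≡u))
... | false = inj₂ (sym (eqᵇ⇒≡ w u u∈pair))

singleton-firing-Q₄ : ∀ (v : V 4) →
  (∀ u → eqᵇ v u ≡ true → outDegree (eqᵇ v) u ≤ 4) ×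
  (∀ u → eqᵇ v u ≡ false → inDegree (eqᵇ v) u ≤ 1) × 15 ≤ weight (eqᵇ v)
singleton-firing-Q₄ = toWitness {a? = all-V? λ v →
  all-V? (λ u → (eqᵇ v u Bool.≟ true) →-dec (outDegree (eqᵇ v) u ℕ.≤? 4)) ×-dec
  all-V? (λ u → (eqᵇ v u Bool.≟ false) →-dec (inDegree (eqᵇ v) u ℕ.≤? 1)) ×-dec
  (15 ℕ.≤? weight (eqᵇ v))} _

pair-firing-Q₄ : ∀ (v w : V 4) → Adj v w →
  (∀ u → pair v w u ≡ true → outDegree (pair v w) u ≤ 3) ×
  (∀ u → pair v w u ≡ false → inDegree (pair v w) u ≤ 1) × 15 ≤ weight (pair v w)
pair-firing-Q₄ = toWitness {a? = all-V? λ v → all-V? λ w → (adjᵇ v w Bool.≟ true) →-dec (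
  all-V? (λ u → (pair v w u Bool.≟ true) →-dec (outDegree (pair v w) u ℕ.≤? 3)) ×-dec
  all-V? (λ u → (pair v w u Bool.≟ false) →-dec (inDegree (pair v w) u ℕ.≤? 1)) ×-dec
  (15 ℕ.≤? weight (pair v w)))} _

-- No vertex can fire alone (that needs 4 chips) and no edge can fire (3 chips at both ends).
Stable : (V 4 → ℕ) → Set
Stable M = (∀ v → M v ≤ 3) × (∀ v w → Adj v w → M v ≤ 2 ⊎ M w ≤ 2)

spread? : ∀ (M : V 4 → ℕ) v w → Dec (Adj v w → M v ≤ 2 ⊎ M w ≤ 2)
spread? M v w = (adjᵇ v w Bool.≟ true) →-dec ((M v ℕ.≤? 2) ⊎-dec (M w ℕ.≤? 2))

stable-or-firable : ∀ (M : V 4 → ℕ) →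
  Stable M ⊎ (∃ λ v → 4 ≤ M v) ⊎ (∃₂ λ v w → Adj v w × 3 ≤ M v × 3 ≤ M w)
stable-or-firable M with all-V? (λ v → M v ℕ.≤? 3)
... | no ¬small with ¬∀⇒∃¬ (λ v → M v ℕ.≤? 3) ¬small
...   | v , Mv≰3 = inj₂ (inj₁ (v , ℕₚ.≰⇒> Mv≰3))
stable-or-firable M | yes small with all-V? (λ v → all-V? (spread? M v))
... | yes spread = inj₁ (small , spread)
... | no ¬spread with ¬∀⇒∃¬ (λ v → all-V? (spread? M v)) ¬spread
...   | v , ¬spread-v with ¬∀⇒∃¬ (spread? M v) ¬spread-v
...     | w , ¬spread-vw = inj₂ (inj₂ (v , w , crowded))
  where
  crowded : Adj v w × 3 ≤ M v × 3 ≤ M w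
  crowded with adjᵇ v w Bool.≟ true | M v ℕ.≤? 2 | M w ℕ.≤? 2
  ... | no ¬adj | _        | _        = ⊥-elim (¬spread-vw (λ adj → ⊥-elim (¬adj adj)))
  ... | yes _   | yes Mv≤2 | _        = ⊥-elim (¬spread-vw (λ _ → inj₁ Mv≤2))
  ... | yes _   | no _     | yes Mw≤2 = ⊥-elim (¬spread-vw (λ _ → inj₂ Mw≤2))
  ... | yes adj | no Mv≰2  | no Mw≰2  = adj , ℕₚ.≰⇒> Mv≰2 , ℕₚ.≰⇒> Mw≰2

firingSet-Q₄ : ∀ (N : V 4 → ℕ) → (∃ λ v → 4 ≤ N v) ⊎ (∃₂ λ v w → Adj v w × 3 ≤ N v × 3 ≤ N w) →
  ∃ λ U → Legal U N × (∀ u → U u ≡ false → inDegree U u ≤ 1) × 15 ≤ weight U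
firingSet-Q₄ N (inj₁ (v , 4≤Nv)) =
  let out≤4 , entering≤1 , heavy = singleton-firing-Q₄ v
      legal : Legal (eqᵇ v) N
      legal u v≡u = subst (λ x → outDegree (eqᵇ v) x ≤ N x) (eqᵇ⇒≡ v u v≡u)
                          (ℕₚ.≤-trans (out≤4 v (eqᵇ-refl v)) 4≤Nv)
  in eqᵇ v , legal , entering≤1 , heavy
firingSet-Q₄ N (inj₂ (v , w , adj , 3≤Nv , 3≤Nw)) =
  let out≤3 , entering≤1 , heavy = pair-firing-Q₄ v w adj
      3≤N : ∀ u → u ≡ v ⊎ u ≡ w → 3 ≤ N u
      3≤N u = [ (λ u≡v → subst (λ x → 3 ≤ N x) (sym u≡v) 3≤Nv)
              , (λ u≡w → subst (λ x → 3 ≤ N x) (sym u≡w) 3≤Nw) ]′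
      legal : Legal (pair v w) N
      legal u u∈pair = ℕₚ.≤-trans (out≤3 u u∈pair) (3≤N u (pair-members v w u u∈pair))
  in pair v w , legal , entering≤1 , heavy

stabilize : ∀ (N : V 4 → ℕ) → ∑ℕ N (allV 4) ≤ 7 →
  ∃ λ M → ⌜ N ⌝ ∼ ⌜ M ⌝ × Stable M × ∑ℕ M (allV 4) ≤ 7
stabilize N small = go N small (<-wellFounded (energy N))
  where
  go : ∀ N → ∑ℕ N (allV 4) ≤ 7 → Acc _<_ (energy N) →
       ∃ λ M → ⌜ N ⌝ ∼ ⌜ M ⌝ × Stable M × ∑ℕ M (allV 4) ≤ 7
  go N small (acc rec) with stable-or-firable N
  ... | inj₁ stable = N , ∼-refl ⌜ N ⌝ , stable , small
  ... | inj₂ firable =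
    let U , legal , entering≤1 , heavy = firingSet-Q₄ N firable
        M , fired∼M , stable , small′ =
          go (fireSet U N) (subst (_≤ 7) (sym (∼-∑ℕ (fireSet-∼ legal))) small)
             (rec (fireSet-decreases-energy legal entering≤1
                    (ℕₚ.≤-trans (s≤s (ℕₚ.+-mono-≤ small small)) heavy)))
    in M , ∼-trans (fireSet-∼ legal) fired∼M , stable , small′

support : (V n → ℕ) → VSet n
support M v = not (M v ℕ.≡ᵇ 0)

size-support≤∑ : ∀ (M : V n → ℕ) → size (support M) ≤ ∑ℕ M (allV n)
size-support≤∑ {n} M = subst (_≤ ∑ℕ M (allV n)) (sym (size≡count (support M))) (∑ℕ-mono (allV n) pointwise)
  where
  pointwise : ∀ v → ⟦ support M v ⟧ ≤ M v
  pointwise v with M v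
  ... | zero  = z≤n
  ... | suc _ = s≤s z≤n

chipFreeEgg-Q₄ : ∀ (M : V 4 → ℕ) → ∑ℕ M (allV 4) ≤ 7 →
  ∃ λ E → E ∈ eggs faceScramble × (∀ v → E v ≡ true → M v ≡ 0)
chipFreeEgg-Q₄ M few with hittingSet-or-avoidedEgg faceScramble (support M)
... | inj₁ hits = ⊥-elim (ℕₚ.<-irrefl refl (ℕₚ.≤-trans (faceScramble-hitting (support M) hits)
                                                      (ℕₚ.≤-trans (size-support≤∑ M) few)))
... | inj₂ (E , E∈ , E∩support≡∅) = E , E∈ , λ v Ev →
  ℕₚ.≡ᵇ⇒≡ (M v) 0 (Equivalence.from Boolₚ.T-≡ (trans (sym (Boolₚ.not-involutive (M v ℕ.≡ᵇ 0))) (E∩support≡∅ v Ev)))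

outDegree+inDegree-Q₄ : ∀ (A : VSet 4) u → outDegree A u + inDegree A u ≡ 4
outDegree+inDegree-Q₄ A u = trans (outDegree+inDegree A u) (valence≡n u)

small-set⇒3≤outDegree : ∀ (A : VSet 4) → size A ≤ 2 → ∀ u → A u ≡ true → 3 ≤ outDegree A u
small-set⇒3≤outDegree A small u Au = ℕₚ.+-cancelʳ-≤ (inDegree A u) 3 (outDegree A u)
  (ℕₚ.≤-trans (ℕₚ.+-monoʳ-≤ 3 (ℕₚ.≤-pred (ℕₚ.≤-trans (suc-inDegree≤size A u Au) small)))
              (ℕₚ.≤-reflexive (sym (outDegree+inDegree-Q₄ A u))))

no-small-legal-set-Q₄ : ∀ (M : V 4 → ℕ) → Stable M → ∀ (A : VSet 4) → size A ≤ 2 →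
  (∀ u → A u ≡ true → outDegree A u ≤ M u) → ∀ v → A v ≡ true → ⊥
no-small-legal-set-Q₄ M (M≤3 , spread) A small legal v Av =
  let w , Aw∧vw = count-pos (λ w → A w ∧ adjᵇ v w) (allV 4) 1≤inDegree
  in [ crowded v Av , crowded w (Boolₚ.∧-conicalˡ _ _ Aw∧vw) ]′ (spread v w (Boolₚ.∧-conicalʳ _ _ Aw∧vw))
  where
  crowded : ∀ u → A u ≡ true → M u ≤ 2 → ⊥
  crowded u Au Mu≤2 = ℕₚ.<-irrefl refl
    (ℕₚ.≤-trans (small-set⇒3≤outDegree A small u Au) (ℕₚ.≤-trans (legal u Au) Mu≤2))
  1≤inDegree : 1 ≤ inDegree A v
  1≤inDegree = ℕₚ.+-cancelˡ-≤ 3 1 (inDegree A v)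
    (ℕₚ.≤-trans (ℕₚ.≤-reflexive (sym (outDegree+inDegree-Q₄ A v)))
                (ℕₚ.+-monoˡ-≤ (inDegree A v) (ℕₚ.≤-trans (legal v Av) (M≤3 v))))

-- Dhar's argument: the vertices where the script g is maximal fire legally from M − q.  They
-- miss q, which has −1 chips, hence the whole chip-free egg (a chip-free vertex of a legal set
-- drags its neighbours in), so isoperimetry leaves at most two of them, against stability.
chipFreeEgg-cannot-be-refilled : ∀ (M : V 4 → ℕ) → Stable M → ∑ℕ M (allV 4) ≤ 7 →
  ∀ {E} → E ∈ eggs faceScramble → (∀ v → E v ≡ true → M v ≡ 0) → InducesConnected E →
  ∀ q → E q ≡ true → ∀ (g : V 4 → ℤ) → Effective (λ w → minusChip ⌜ M ⌝ q w ℤ.- laplacian g w) →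
  ∀ top → (∀ u → g u ℤ.≤ g top) → ⊥
chipFreeEgg-cannot-be-refilled M stable few {E} E∈ chipFree connected q Eq g effective top g≤top =
  no-small-legal-set-Q₄ M stable A |A|≤2 legal top top∈A
  where
  A : VSet 4
  A u = g top ℤ.≤ᵇ g u
  top∈A : A top ≡ true
  top∈A = Equivalence.to Boolₚ.T-≡ (ℤₚ.≤⇒≤ᵇ (ℤₚ.≤-refl {g top}))
  legalℤ : ∀ u → A u ≡ true → + outDegree A u ℤ.≤ minusChip ⌜ M ⌝ q u
  legalℤ u Au = ℤₚ.≤-trans
    (outDegree-level≤laplacian g (g top) u g≤top (ℤₚ.≤-antisym (g≤top u) (ℤₚ.≤ᵇ⇒≤ (Equivalence.from Boolₚ.T-≡ Au))))
    (ℤₚ.0≤i-j⇒j≤i (effective u))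
  legal : ∀ u → A u ≡ true → outDegree A u ≤ M u
  legal u Au = ℤₚ.drop‿+≤+ (ℤₚ.≤-trans (legalℤ u Au) (minusChip≤ M q u))
  q∉A : A q ≡ true → ⊥
  q∉A Aq with subst (+ outDegree A q ℤ.≤_)
                    (trans (minusChip-at M q) (cong (λ k → + k ℤ.- + 1) (chipFree q Eq))) (legalℤ q Aq)
  ... | ()
  chipFree-closed : ∀ u w → E u ≡ true → A u ≡ true → Adj u w → A w ≡ true
  chipFree-closed u w Eu Au uw = outDegree≡0⇒Adj⇒∈ A u w
    (ℕₚ.n≤0⇒n≡0 (subst (outDegree A u ≤_) (chipFree u Eu) (legal u Au))) uw
  E⊆Aᶜ : SubsetOf E (complement A)
  E⊆Aᶜ v Ev with A v in Av
  ... | true  = ⊥-elim (q∉A (walk-closed chipFree-closed (connected v q Ev Eq) Av))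
  ... | false = refl
  cut≤7 : cutSize A ≤ 7
  cut≤7 = ℕₚ.≤-trans (ℕₚ.≤-trans (ℕₚ.≤-reflexive (cutSize≡∑outDegree A)) (∑ℕ-mono (allV 4) pointwise)) few
    where
    pointwise : ∀ u → (if A u then outDegree A u else 0) ≤ M u
    pointwise u with A u in Au
    ... | true  = legal u Au
    ... | false = z≤n
  |A|≤2 : size A ≤ 2
  |A|≤2 with 3 ℕ.≤? size A
  ... | yes 3≤|A| = ⊥-elim (ℕₚ.<-irrefl refl
          (ℕₚ.≤-trans (isoperimetric-Q₄ A 3≤|A| (avoids-egg⇒size≤13 A E∈ E⊆Aᶜ)) cut≤7))
  ... | no 3≰|A| = ℕₚ.≤-pred (ℕₚ.≰⇒> 3≰|A|)

stable⇒¬PositiveRank∼ : ∀ (M : V 4 → ℕ) → Stable M → ∑ℕ M (allV 4) ≤ 7 → ¬ PositiveRank∼ ⌜ M ⌝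
stable⇒¬PositiveRank∼ M stable few rank =
  let E , E∈ , chipFree = chipFreeEgg-Q₄ M few
      (q , Eq) , connected = eggsAreEggs faceScramble E∈
      D′ , mk∼ g fired , effective = rank q
      top , g≤top = maximum g q
  in chipFreeEgg-cannot-be-refilled M stable few E∈ chipFree connected q Eq g
       (λ w → subst (+ 0 ℤ.≤_) (fired w) (effective w)) top g≤top

corner : V 4
corner = true ∷ true ∷ true ∷ true ∷ []

gonality-Q₄≥8 : ∀ (D : Divisor 4) → PositiveRank D → + 8 ℤ.≤ degree D
gonality-Q₄≥8 D rank with + 8 ℤₚ.≤? degree D
... | yes 8≤deg = 8≤deg
... | no 8≰deg =
  let D₀ , D-corner→D₀ , effective = rank corner
      N₀ : V 4 → ℕ
      N₀ w = ℤ.∣ D₀ w ℤ.+ 𝟙 (eqᵇ corner) w ∣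
      D∼N₀ : D ∼ ⌜ N₀ ⌝
      D∼N₀ = ∼-respʳ (λ w → sym (ℤₚ.0≤i⇒+∣i∣≡i (ℤₚ.+-mono-≤ (effective w) (𝟙≥0 w))))
                     (minusChip∼⇒∼+𝟙 corner (Equiv⇒∼ D-corner→D₀))
      few : ∑ℕ N₀ (allV 4) ≤ 7
      few = ℕₚ.≤-pred (ℤₚ.drop‿+<+ (subst (ℤ._< + 8)
              (trans (sym (∼-degree D∼N₀)) (degree-⌜⌝ N₀)) (ℤₚ.≰⇒> 8≰deg)))
      M , N₀∼M , stable , few′ = stabilize N₀ few
  in ⊥-elim (stable⇒¬PositiveRank∼ M stable few′
       (PositiveRank∼-resp-∼ (∼-trans D∼N₀ N₀∼M) (PositiveRank⇒PositiveRank∼ rank)))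
  where
  𝟙≥0 : ∀ w → + 0 ℤ.≤ 𝟙 (eqᵇ corner) w
  𝟙≥0 w with eqᵇ corner w
  ... | true  = ℤ.+≤+ z≤n
  ... | false = ℤ.+≤+ z≤n

gonality-Q₄ : GonalityIs 4 8
gonality-Q₄ = (facetDivisor , facetDivisor-rank , refl) , gonality-Q₄≥8

theorem3p13 : ScrambleNumberIs 4 8 × GonalityIs 4 8
theorem3p13 = scrambleNumber-Q₄ , gonality-Q₄
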